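{- Let $U$ be an unrooted binary phylogenetic network. If $U$ is $2$-cuttable, then $U$ is an orchard network.
   Context: An unrooted binary phylogenetic network on a non-empty finite set $X$ is a simple connected undirected graph whose internal vertices have degree $3$ and whose degree-$1$ vertices (leaves) are bijectively labeled by $X$. A cut-edge is an edge whose deletion disconnects the graph. $U$ is $2$-cuttable if every cycle contains a path of at least $2$ vertices each incident to a cut-edge. For distinct leaves $x,y$: $\{x,y\}$ is a cherry if $|X|=2$ or $x,y$ are adjacent to a common vertex; $\{x,y\}$ is a reticulated cherry if there are distinct internal vertices $u,v$ with $\{x,u\},\{u,v\},\{v,y\}$ edges and $\{u,v\}$ lying on a cycle (the central edge). Reducing an ordered pair $(x,y)$: if $\{x,y\}$ is a cherry, delete $x$ and, if $|X|\ge 3$, suppress the resulting degree-$2$ vertex; if $\{x,y\}$ is a reticulated cherry, delete its central edge and suppress the two resulting degree-$2$ vertices. A sequence $((x_1,y_1),\dots,(x_s,y_s))$ is a cherry-picking sequence for $U$ if, starting from $U_0=U$, each $\{x_i,y_i\}$ is a cherry or reticulated cherry of $U_{i-1}$, $U_i$ is obtained by reducing $(x_i,y_i)$, and $U_s$ is a single vertex. $U$ is an orchard network if it has a cherry-picking sequence. -}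

module Defs where

open import Data.Nat using (ℕ; suc; _≡ᵇ_; _≤_; _≤ᵇ_)
open import Data.Bool using (Bool; true; false; _∧_; _∨_; not; if_then_else_)
open import Data.List using (List; []; _∷_; _++_; length; filterᵇ)
open import Data.List.Membership.Propositional using (_∈_)
open import Data.List.Relation.Unary.Unique.Propositional using (Unique)
open import Data.Product using (Σ; ∃; ∃-syntax; _×_; _,_)
open import Data.Sum using (_⊎_)
open import Data.Unit using (⊤)
open import Data.Empty using (⊥)
open import Relation.Binary.PropositionalEquality using (_≡_; _≢_)
open import Relation.Nullary using (¬_)

-- The vertex set is the list V; u and v are adjacent iff adj u v ≡ true.
-- (Being simple/undirected, i.e. adj symmetric, irreflexive and supported
--  on V, is imposed in IsNetwork.)

record Graph : Set where
  field
    V   : List ℕ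
    adj : ℕ → ℕ → Bool
open Graph public

neighbours : Graph → ℕ → List ℕ
neighbours G v = filterᵇ (adj G v) (V G)

deg : Graph → ℕ → ℕ
deg G v = length (neighbours G v)

data Walk (G : Graph) : ℕ → ℕ → Set where
  here : ∀ {u} → u ∈ V G → Walk G u u
  step : ∀ {u w v} → u ∈ V G → adj G u w ≡ true → Walk G w v → Walk G u v

Connected : Graph → Set
Connected G = ∀ u v → u ∈ V G → v ∈ V G → Walk G u v

deleteVertex : Graph → ℕ → Graph
deleteVertex G x = record
  { V   = filterᵇ (λ a → not (a ≡ᵇ x)) (V G)
  ; adj = λ a b → adj G a b ∧ not (a ≡ᵇ x) ∧ not (b ≡ᵇ x) }

deleteEdge : Graph → ℕ → ℕ → Graph
deleteEdge G u v = record
  { V   = V G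
  ; adj = λ a b → adj G a b ∧ not (((a ≡ᵇ u) ∧ (b ≡ᵇ v)) ∨ ((a ≡ᵇ v) ∧ (b ≡ᵇ u))) }

addEdge : Graph → ℕ → ℕ → Graph
addEdge G u v = record
  { V   = V G
  ; adj = λ a b → adj G a b ∨ ((a ≡ᵇ u) ∧ (b ≡ᵇ v)) ∨ ((a ≡ᵇ v) ∧ (b ≡ᵇ u)) }

-- suppress a degree-2 vertex w with neighbours a, b: delete w, add edge ab.
-- (Only ever applied to degree-2 vertices; otherwise it does nothing.)
suppress : Graph → ℕ → Graph
suppress G w with neighbours G w
... | a ∷ b ∷ [] = addEdge (deleteVertex G w) a b
... | _          = G

ChainAdj : Graph → List ℕ → Set
ChainAdj G []            = ⊤
ChainAdj G (a ∷ [])      = ⊤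
ChainAdj G (a ∷ b ∷ cs)  = adj G a b ≡ true × ChainAdj G (b ∷ cs)

closed : ℕ → List ℕ → List ℕ
closed v ws = v ∷ ws ++ v ∷ []

Cycle : Graph → ℕ → List ℕ → Set
Cycle G v ws = (∀ a → a ∈ (v ∷ ws) → a ∈ V G)
             × Unique (v ∷ ws) × 2 ≤ length ws × ChainAdj G (closed v ws)

Consec : List ℕ → ℕ → ℕ → Set
Consec []           x y = ⊥
Consec (a ∷ [])     x y = ⊥
Consec (a ∷ b ∷ cs) x y = (x ≡ a × y ≡ b) ⊎ Consec (b ∷ cs) x y

OnCycle : Graph → ℕ → ℕ → Set
OnCycle G u v = ∃[ c ] ∃[ ws ] Cycle G c ws
                × (Consec (closed c ws) u v ⊎ Consec (closed c ws) v u)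

CutEdge : Graph → ℕ → ℕ → Set
CutEdge G u v = adj G u v ≡ true × ¬ Connected (deleteEdge G u v)

IncidentToCutEdge : Graph → ℕ → Set
IncidentToCutEdge G a = ∃[ b ] CutEdge G a b

-- every cycle contains a path of (at least) 2 vertices, each incident to a
-- cut-edge; equivalently two consecutive cycle vertices with that property
TwoCuttable : Graph → Set
TwoCuttable G = ∀ c ws → Cycle G c ws →
  ∃[ a ] ∃[ b ] Consec (closed c ws) a b
              × IncidentToCutEdge G a × IncidentToCutEdge G b

-- unrooted binary phylogenetic networks.  The leaf set X is identified with
-- the set of degree-1 vertices (the labelling is the identity).

Leaf : Graph → ℕ → Set
Leaf G x = x ∈ V G × deg G x ≡ 1

leaves : Graph → List ℕ
leaves G = filterᵇ (λ v → deg G v ≡ᵇ 1) (V G)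

Internal : Graph → ℕ → Set
Internal G u = u ∈ V G × deg G u ≢ 1

record IsNetwork (G : Graph) : Set where
  field
    uniqueV   : Unique (V G)
    symmetric : ∀ u v → adj G u v ≡ adj G v u
    irrefl    : ∀ u → adj G u u ≡ false
    inV       : ∀ u v → adj G u v ≡ true → u ∈ V G
    connected : Connected G
    degrees   : ∀ v → v ∈ V G → deg G v ≡ 1 ⊎ deg G v ≡ 3
    nonEmptyX : ∃[ x ] Leaf G x

IsCherry : Graph → ℕ → ℕ → Set
IsCherry G x y = x ≢ y × Leaf G x × Leaf G y
  × (length (leaves G) ≡ 2 ⊎ ∃[ w ] (adj G x w ≡ true × adj G y w ≡ true))

IsRetCherryVia : Graph → ℕ → ℕ → ℕ → ℕ → Set
IsRetCherryVia G x y u v = x ≢ y × Leaf G x × Leaf G y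
  × u ≢ v × Internal G u × Internal G v
  × adj G x u ≡ true × adj G u v ≡ true × adj G v y ≡ true
  × OnCycle G u v

IsRetCherry : Graph → ℕ → ℕ → Set
IsRetCherry G x y = ∃[ u ] ∃[ v ] IsRetCherryVia G x y u v

reduceCherry : Graph → ℕ → Graph
reduceCherry G x with neighbours G x
... | p ∷ _ = if 3 ≤ᵇ length (leaves G)
                then suppress (deleteVertex G x) p
                else deleteVertex G x
... | []    = deleteVertex G x

reduceRetCherry : Graph → ℕ → ℕ → Graph
reduceRetCherry G u v = suppress (suppress (deleteEdge G u v) u) v

SingleVertex : Graph → Set
SingleVertex G = ∃[ v ] (V G ≡ v ∷ [] × adj G v v ≡ false)

IsCherryPickingSeq : Graph → List (ℕ × ℕ) → Set
IsCherryPickingSeq G []             = SingleVertex G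
IsCherryPickingSeq G ((x , y) ∷ s) =
    (IsCherry G x y × IsCherryPickingSeq (reduceCherry G x) s)
  ⊎ (∃[ u ] ∃[ v ] (IsRetCherryVia G x y u v
                     × IsCherryPickingSeq (reduceRetCherry G u v) s))

Orchard : Graph → Set
Orchard G = ∃[ s ] IsCherryPickingSeq G s

module Submission where

-- Induction on the number of vertices. A 2-cuttable network is a single edge between two
-- leaves (picked in one step), or it has a cherry or a reticulated cherry. Reducing it gives
-- a smaller 2-cuttable network: deleting a leaf, deleting an edge that lies on a cycle (never
-- a cut-edge, so the graph stays connected) and suppressing the degree-2 vertices this creates
-- keep all degrees, and keep every cut-edge at a vertex of a cycle a cut-edge.
--
-- A (reticulated) cherry is found by a path search. Starting at a leaf, maintain a simple path
-- whose first edge is a cut-edge, and extend it greedily through unvisited internal vertices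
-- until the head is stuck. Two fresh leaves at the head form a cherry. A head adjacent to its
-- own extension closes a cycle of internal vertices; by 2-cuttability two adjacent vertices of
-- that cycle carry cut-edges, whose far ends are either leaves, giving a reticulated cherry, or
-- start a longer such path. A head adjacent to the start of the path is handled by searching
-- back along the extension. Simple paths have at most |V| vertices, so the search ends.

open import Defs
open import Data.Bool using (Bool; true; false; _∧_; _∨_; not; if_then_else_; T)
open import Data.Bool.Properties using (T-≡; ∧-identityʳ; ∨-identityʳ)
open import Data.Empty using (⊥; ⊥-elim)
open import Data.List using (List; []; _∷_; _++_; length; filterᵇ)
open import Data.List.Properties using (length-++; ++-assoc)
open import Data.List.Membership.Propositional using (_∈_; _∉_)
open import Data.List.Membership.Propositional.Properties using (∈-++⁺ˡ; ∈-++⁺ʳ; ∈-++⁻; ∈-∃++; ∈-insert; ∈-length)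
open import Data.List.Relation.Unary.All using (All) renaming ([] to []ᴬ; _∷_ to _∷ᴬ_)
open import Data.List.Relation.Unary.AllPairs using () renaming ([] to []ᴾ; _∷_ to _∷ᴾ_)
open import Data.List.Relation.Unary.Any using (here; there)
open import Data.List.Relation.Unary.Unique.Propositional using (Unique)
open import Data.List.Relation.Unary.Unique.Propositional.Properties using (Unique[x∷xs]⇒x∉xs)
open import Data.Nat using (ℕ; zero; suc; _≡ᵇ_; _≤_; _<_; z≤n; s≤s; _+_; _≤ᵇ_)
open import Data.Nat.Properties
  using (_≟_; ≡ᵇ⇒≡; ≤-refl; ≤-reflexive; ≤-trans; ≤-antisym; <-≤-trans; n≮n; ≤-pred; n≤1+n; m≤n+m; suc-injective;
         +-suc; +-comm; +-identityʳ; +-monoˡ-≤; ≤⇒≤ᵇ)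
open import Data.List.Membership.DecPropositional _≟_ using (_∈?_)
open import Data.Product using (Σ; _×_; _,_; proj₁; proj₂)
open import Data.Sum using (_⊎_; inj₁; inj₂; map₂; swap; [_,_])
open import Data.Unit using (tt)
open import Function.Base using (case_of_)
open import Function.Bundles using (Equivalence)
open import Relation.Binary.PropositionalEquality using (_≡_; _≢_; refl; sym; trans; cong; subst)
open import Relation.Nullary using (¬_; Dec; yes; no)

≡ᵇ-refl : ∀ n → (n ≡ᵇ n) ≡ true
≡ᵇ-refl zero = refl
≡ᵇ-refl (suc n) = ≡ᵇ-refl n

≡ᵇ-true : ∀ {m n} → (m ≡ᵇ n) ≡ true → m ≡ n
≡ᵇ-true {m} {n} e = ≡ᵇ⇒≡ m n (subst T (sym e) tt)

≡ᵇ-false : ∀ {m n} → m ≢ n → (m ≡ᵇ n) ≡ false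
≡ᵇ-false {m} {n} ne with m ≡ᵇ n in eq
... | true = ⊥-elim (ne (≡ᵇ-true eq))
... | false = refl

∧-true⁻ˡ : ∀ {a b} → (a ∧ b) ≡ true → a ≡ true
∧-true⁻ˡ {true} e = refl

∧-true⁻ʳ : ∀ {a b} → (a ∧ b) ≡ true → b ≡ true
∧-true⁻ʳ {true} e = e

∧-true⁺ : ∀ {a b} → a ≡ true → b ≡ true → (a ∧ b) ≡ true
∧-true⁺ refl refl = refl

∨-true⁻ : ∀ {a b} → (a ∨ b) ≡ true → a ≡ true ⊎ b ≡ true
∨-true⁻ {true} e = inj₁ refl
∨-true⁻ {false} e = inj₂ e

∨-true⁺ˡ : ∀ {a b} → a ≡ true → (a ∨ b) ≡ true
∨-true⁺ˡ refl = refl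

∨-true⁺ʳ : ∀ {a b} → b ≡ true → (a ∨ b) ≡ true
∨-true⁺ʳ {true} e = refl
∨-true⁺ʳ {false} e = e

not-true⁻ : ∀ {a} → not a ≡ true → a ≡ false
not-true⁻ {false} e = refl

not-true⁺ : ∀ {a} → a ≡ false → not a ≡ true
not-true⁺ refl = refl

not-≡ᵇ⇒≢ : ∀ {m n} → not (m ≡ᵇ n) ≡ true → m ≢ n
not-≡ᵇ⇒≢ {m} e refl = tf {m} (not-true⁻ e)
  where
  tf : ∀ {m} → (m ≡ᵇ m) ≡ false → ⊥
  tf {m} e2 with trans (sym (≡ᵇ-refl m)) e2
  ... | ()

≢⇒not-≡ᵇ : ∀ {m n} → m ≢ n → not (m ≡ᵇ n) ≡ true
≢⇒not-≡ᵇ ne = not-true⁺ (≡ᵇ-false ne)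

true≢false : true ≢ false
true≢false ()

∈-filter⁻ : ∀ {p : ℕ → Bool} {z} xs → z ∈ filterᵇ p xs → z ∈ xs × p z ≡ true
∈-filter⁻ {p} (x ∷ xs) m with p x in eq
∈-filter⁻ {p} (x ∷ xs) (here refl) | true = here refl , eq
∈-filter⁻ {p} (x ∷ xs) (there m) | true with ∈-filter⁻ {p} xs m
... | a , b = there a , b
∈-filter⁻ {p} (x ∷ xs) m | false with ∈-filter⁻ {p} xs m
... | a , b = there a , b

∈-filter⁺ : ∀ {p : ℕ → Bool} {z} xs → z ∈ xs → p z ≡ true → z ∈ filterᵇ p xs
∈-filter⁺ {p} (x ∷ xs) m pz with p x in eq
∈-filter⁺ {p} (x ∷ xs) (here refl) pz | true = here refl
∈-filter⁺ {p} (x ∷ xs) (there m) pz | true = there (∈-filter⁺ {p} xs m pz)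
∈-filter⁺ {p} (x ∷ xs) (here refl) pz | false with trans (sym pz) eq
... | ()
∈-filter⁺ {p} (x ∷ xs) (there m) pz | false = ∈-filter⁺ {p} xs m pz

∉⇒All : ∀ {x : ℕ} xs → x ∉ xs → All (x ≢_) xs
∉⇒All [] _ = []ᴬ
∉⇒All (y ∷ ys) n = (λ e → n (here e)) ∷ᴬ ∉⇒All ys (λ m → n (there m))

uniq-cons : ∀ {x : ℕ} {xs} → x ∉ xs → Unique xs → Unique (x ∷ xs)
uniq-cons {x} {xs} n u = ∉⇒All xs n ∷ᴾ u

uniq-nil : Unique {A = ℕ} []
uniq-nil = []ᴾ

uniq-tail : ∀ {x : ℕ} {xs} → Unique (x ∷ xs) → Unique xs
uniq-tail (_ ∷ᴾ u) = u

uniq-head : ∀ {x : ℕ} {xs} → Unique (x ∷ xs) → x ∉ xs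
uniq-head = Unique[x∷xs]⇒x∉xs

uniq-filter : ∀ (p : ℕ → Bool) xs → Unique xs → Unique (filterᵇ p xs)
uniq-filter p [] u = []ᴾ
uniq-filter p (x ∷ xs) u with p x in eq
... | true = uniq-cons (λ m → uniq-head u (proj₁ (∈-filter⁻ {p} xs m))) (uniq-filter p xs (uniq-tail u))
... | false = uniq-filter p xs (uniq-tail u)

remove : ℕ → List ℕ → List ℕ
remove x = filterᵇ (λ a → not (a ≡ᵇ x))

∈-remove⁺ : ∀ {x z} ys → z ∈ ys → z ≢ x → z ∈ remove x ys
∈-remove⁺ {x} {z} ys m ne = ∈-filter⁺ {λ a → not (a ≡ᵇ x)} ys m (≢⇒not-≡ᵇ ne)

∈-remove⁻ : ∀ {x z} ys → z ∈ remove x ys → z ∈ ys × z ≢ x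
∈-remove⁻ {x} {z} ys m with ∈-filter⁻ {λ a → not (a ≡ᵇ x)} ys m
... | a , b = a , not-≡ᵇ⇒≢ b

length-remove-< : ∀ {x} ys → x ∈ ys → suc (length (remove x ys)) ≤ length ys
length-remove-< {x} (y ∷ ys) m with not (y ≡ᵇ x) in eq
length-remove-< {x} (y ∷ ys) (here refl) | true = ⊥-elim (not-≡ᵇ⇒≢ {x} eq refl)
length-remove-< {x} (y ∷ ys) (there m) | true = s≤s (length-remove-< ys m)
length-remove-< {x} (y ∷ ys) m | false = s≤s (len-rem ys)
  where
  len-rem : ∀ zs → length (remove x zs) ≤ length zs
  len-rem [] = z≤n
  len-rem (z ∷ zs) with not (z ≡ᵇ x)
  ... | true = s≤s (len-rem zs)
  ... | false = ≤-trans (len-rem zs) (n≤1+n _)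

Sub : List ℕ → List ℕ → Set
Sub xs ys = ∀ z → z ∈ xs → z ∈ ys

unique-sub-length≤ : ∀ xs ys → Unique xs → Sub xs ys → length xs ≤ length ys
unique-sub-length≤ [] ys u s = z≤n
unique-sub-length≤ (x ∷ xs) ys u s =
  ≤-trans (s≤s (unique-sub-length≤ xs (remove x ys) (uniq-tail u)
     (λ z m → ∈-remove⁺ ys (s z (there m)) (λ e → uniq-head u (subst (_∈ xs) e m)))))
   (length-remove-< ys (s x (here refl)))

unique-sub-length≡ : ∀ xs ys → Unique xs → Unique ys → Sub xs ys → Sub ys xs → length xs ≡ length ys
unique-sub-length≡ xs ys u1 u2 s1 s2 = ≤-antisym (unique-sub-length≤ xs ys u1 s1) (unique-sub-length≤ ys xs u2 s2)

length-filter-cong : ∀ (P Q : ℕ → Bool) xs → (∀ z → z ∈ xs → P z ≡ Q z) → length (filterᵇ P xs) ≡ length (filterᵇ Q xs)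
length-filter-cong P Q [] h = refl
length-filter-cong P Q (x ∷ xs) h with P x | Q x | h x (here refl)
... | true | true | _ = cong suc (length-filter-cong P Q xs (λ z m → h z (there m)))
... | false | false | _ = length-filter-cong P Q xs (λ z m → h z (there m))

length-filter-suc : ∀ (P Q : ℕ → Bool) xs z0 → Unique xs → z0 ∈ xs → P z0 ≡ false → Q z0 ≡ true →
  (∀ z → z ∈ xs → z ≢ z0 → P z ≡ Q z) → length (filterᵇ Q xs) ≡ suc (length (filterᵇ P xs))
length-filter-suc P Q (x ∷ xs) z0 u (here refl) pf qt h with P x | Q x
... | false | true = cong suc (length-filter-cong Q P xs (λ z m → sym (h z (there m) (λ e → uniq-head u (subst (_∈ xs) e m)))))
... | true | _ = ⊥-elim (true≢false pf)
... | false | false = ⊥-elim (true≢false (sym qt))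
length-filter-suc P Q (x ∷ xs) z0 u (there m0) pf qt h with P x | Q x | h x (here refl) (λ e → uniq-head u (subst (_∈ xs) (sym e) m0))
... | true | true | _ = cong suc (length-filter-suc P Q xs z0 (uniq-tail u) m0 pf qt (λ z m ne → h z (there m) ne))
... | false | false | _ = length-filter-suc P Q xs z0 (uniq-tail u) m0 pf qt (λ z m ne → h z (there m) ne)

length-filter-filter : ∀ (P R : ℕ → Bool) xs → length (filterᵇ P (filterᵇ R xs)) ≡ length (filterᵇ (λ z → R z ∧ P z) xs)
length-filter-filter P R [] = refl
length-filter-filter P R (x ∷ xs) with R x
... | false = length-filter-filter P R xs
... | true with P x
... | true = cong suc (length-filter-filter P R xs)
... | false = length-filter-filter P R xs

∈-neighbours⁻ : ∀ G v z → z ∈ neighbours G v → z ∈ V G × adj G v z ≡ true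
∈-neighbours⁻ G v z m = ∈-filter⁻ {adj G v} (V G) m

∈-neighbours⁺ : ∀ G v z → z ∈ V G → adj G v z ≡ true → z ∈ neighbours G v
∈-neighbours⁺ G v z m a = ∈-filter⁺ {adj G v} (V G) m a

uniq-neighbours : ∀ G v → Unique (V G) → Unique (neighbours G v)
uniq-neighbours G v u = uniq-filter (adj G v) (V G) u

length≡1 : ∀ (L : List ℕ) → length L ≡ 1 → Σ ℕ λ a → L ≡ a ∷ []
length≡1 (a ∷ []) e = a , refl

length≡2 : ∀ (L : List ℕ) → length L ≡ 2 → Σ ℕ λ a → Σ ℕ λ b → L ≡ a ∷ b ∷ []
length≡2 (a ∷ b ∷ []) e = a , b , refl

length≡3 : ∀ (L : List ℕ) → length L ≡ 3 → Σ ℕ λ a → Σ ℕ λ b → Σ ℕ λ c → L ≡ a ∷ b ∷ c ∷ []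
length≡3 (a ∷ b ∷ c ∷ []) e = a , b , c , refl

record Nbr (G : Graph) (v z : ℕ) : Set where
  constructor mkNbr
  field
    nbrV : z ∈ V G
    nbrAdj : adj G v z ≡ true
open Nbr public

record Deg1 (G : Graph) (v : ℕ) : Set where
  constructor mkDeg1
  field
    p : ℕ
    pN : Nbr G v p
    only : ∀ z → Nbr G v z → z ≡ p

deg1-view : ∀ G v → deg G v ≡ 1 → Deg1 G v
deg1-view G v e with length≡1 (neighbours G v) e
... | a , eq = mkDeg1 a (let (x , y) = ∈-neighbours⁻ G v a (subst (a ∈_) (sym eq) (here refl)) in mkNbr x y)
   (λ z n → f z (subst (z ∈_) eq (∈-neighbours⁺ G v z (nbrV n) (nbrAdj n))))
  where
  f : ∀ z → z ∈ a ∷ [] → z ≡ a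
  f z (here e) = e

record Deg3 (G : Graph) (v : ℕ) : Set where
  constructor mkDeg3
  field
    a b c : ℕ
    aN : Nbr G v a
    bN : Nbr G v b
    cN : Nbr G v c
    ab : a ≢ b
    ac : a ≢ c
    bc : b ≢ c
    only : ∀ z → Nbr G v z → z ≡ a ⊎ z ≡ b ⊎ z ≡ c

mem3 : ∀ {z a b c : ℕ} → z ∈ a ∷ b ∷ c ∷ [] → z ≡ a ⊎ z ≡ b ⊎ z ≡ c
mem3 (here e) = inj₁ e
mem3 (there (here e)) = inj₂ (inj₁ e)
mem3 (there (there (here e))) = inj₂ (inj₂ e)

deg3-view : ∀ G v → Unique (V G) → deg G v ≡ 3 → Deg3 G v
deg3-view G v uV e with length≡3 (neighbours G v) e | uniq-neighbours G v uV
... | a , b , c , eq | u with subst Unique eq u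
... | (a≢b ∷ᴬ a≢c ∷ᴬ []ᴬ) ∷ᴾ (b≢c ∷ᴬ []ᴬ) ∷ᴾ []ᴬ ∷ᴾ []ᴾ =
  mkDeg3 a b c (nn a (here refl)) (nn b (there (here refl))) (nn c (there (there (here refl))))
    a≢b a≢c b≢c (λ z n → mem3 (subst (z ∈_) eq (∈-neighbours⁺ G v z (nbrV n) (nbrAdj n))))
  where
  nn : ∀ z → z ∈ a ∷ b ∷ c ∷ [] → Nbr G v z
  nn z m = let (x , y) = ∈-neighbours⁻ G v z (subst (z ∈_) (sym eq) m) in mkNbr x y

record Deg2 (G : Graph) (v : ℕ) : Set where
  constructor mkDeg2
  field
    a b : ℕ
    eqn : neighbours G v ≡ a ∷ b ∷ []
    aN : Nbr G v a
    bN : Nbr G v b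
    ab : a ≢ b
    only : ∀ z → Nbr G v z → z ≡ a ⊎ z ≡ b

mem2 : ∀ {z a b : ℕ} → z ∈ a ∷ b ∷ [] → z ≡ a ⊎ z ≡ b
mem2 (here e) = inj₁ e
mem2 (there (here e)) = inj₂ e

deg2-view : ∀ G v → Unique (V G) → deg G v ≡ 2 → Deg2 G v
deg2-view G v uV e with length≡2 (neighbours G v) e | uniq-neighbours G v uV
... | a , b , eq | u with subst Unique eq u
... | (a≢b ∷ᴬ []ᴬ) ∷ᴾ []ᴬ ∷ᴾ []ᴾ =
  mkDeg2 a b eq (nn a (here refl)) (nn b (there (here refl)))
    a≢b (λ z n → mem2 (subst (z ∈_) eq (∈-neighbours⁺ G v z (nbrV n) (nbrAdj n))))
  where
  nn : ∀ z → z ∈ a ∷ b ∷ [] → Nbr G v z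
  nn z m = let (x , y) = ∈-neighbours⁻ G v z (subst (z ∈_) (sym eq) m) in mkNbr x y

data ≡ᵇ-View (m n : ℕ) : Set where
  isEq : (m ≡ᵇ n) ≡ true → m ≡ n → ≡ᵇ-View m n
  isNe : (m ≡ᵇ n) ≡ false → m ≢ n → ≡ᵇ-View m n

≡ᵇ-view : ∀ m n → ≡ᵇ-View m n
≡ᵇ-view m n with m ≟ n
... | yes refl = isEq (≡ᵇ-refl m) refl
... | no ne = isNe (≡ᵇ-false ne) ne

deleteVertex-V⁻ : ∀ G x z → z ∈ V (deleteVertex G x) → z ∈ V G × z ≢ x
deleteVertex-V⁻ G x z m = ∈-remove⁻ (V G) m

deleteVertex-V⁺ : ∀ G x z → z ∈ V G → z ≢ x → z ∈ V (deleteVertex G x)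
deleteVertex-V⁺ G x z m ne = ∈-remove⁺ (V G) m ne

deleteVertex-adj⁻ : ∀ G x s t → adj (deleteVertex G x) s t ≡ true → adj G s t ≡ true × s ≢ x × t ≢ x
deleteVertex-adj⁻ G x s t e = ∧-true⁻ˡ e , not-≡ᵇ⇒≢ (∧-true⁻ˡ (∧-true⁻ʳ {adj G s t} e)) , not-≡ᵇ⇒≢ (∧-true⁻ʳ {not (s ≡ᵇ x)} (∧-true⁻ʳ {adj G s t} e))

deleteVertex-adj⁺ : ∀ G x s t → adj G s t ≡ true → s ≢ x → t ≢ x → adj (deleteVertex G x) s t ≡ true
deleteVertex-adj⁺ G x s t e n1 n2 = ∧-true⁺ e (∧-true⁺ (≢⇒not-≡ᵇ n1) (≢⇒not-≡ᵇ n2))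

deleteVertex-adj-false : ∀ G x s t → adj G s t ≡ false → adj (deleteVertex G x) s t ≡ false
deleteVertex-adj-false G x s t e rewrite e = refl

deleteEdge-adj⁻ : ∀ G u v s t → adj (deleteEdge G u v) s t ≡ true →
  adj G s t ≡ true × ¬ (s ≡ u × t ≡ v) × ¬ (s ≡ v × t ≡ u)
deleteEdge-adj⁻ G u v s t e = ∧-true⁻ˡ e , f1 , f2
  where
  nx : ((s ≡ᵇ u) ∧ (t ≡ᵇ v) ∨ (s ≡ᵇ v) ∧ (t ≡ᵇ u)) ≡ false
  nx = not-true⁻ (∧-true⁻ʳ {adj G s t} e)
  f1 : ¬ (s ≡ u × t ≡ v)
  f1 (refl , refl) = true≢false (trans (sym (∨-true⁺ˡ (∧-true⁺ (≡ᵇ-refl s) (≡ᵇ-refl t)))) nx)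
  f2 : ¬ (s ≡ v × t ≡ u)
  f2 (refl , refl) = true≢false (trans (sym (∨-true⁺ʳ {(s ≡ᵇ u) ∧ (t ≡ᵇ v)} (∧-true⁺ (≡ᵇ-refl s) (≡ᵇ-refl t)))) nx)

deleteEdge-adj⁺ : ∀ G u v s t → adj G s t ≡ true → ¬ (s ≡ u × t ≡ v) → ¬ (s ≡ v × t ≡ u) →
  adj (deleteEdge G u v) s t ≡ true
deleteEdge-adj⁺ G u v s t e n1 n2 rewrite e with ≡ᵇ-view s u | ≡ᵇ-view t v | ≡ᵇ-view s v | ≡ᵇ-view t u
... | isEq _ p | isEq _ q | _ | _ = ⊥-elim (n1 (p , q))
... | _ | _ | isEq _ p | isEq _ q = ⊥-elim (n2 (p , q))
... | isNe a _ | _ | isNe b _ | _ rewrite a | b = refl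
... | isNe a _ | _ | isEq b _ | isNe c _ rewrite a | b | c = refl
... | isEq a _ | isNe b _ | isNe c _ | _ rewrite a | b | c = refl
... | isEq a _ | isNe b _ | isEq c _ | isNe d _ rewrite a | b | c | d = refl

deleteEdge-adj-false : ∀ G u v s t → adj G s t ≡ false → adj (deleteEdge G u v) s t ≡ false
deleteEdge-adj-false G u v s t e rewrite e = refl

addEdge-adj⁻ : ∀ G a b s t → adj (addEdge G a b) s t ≡ true →
  adj G s t ≡ true ⊎ (s ≡ a × t ≡ b) ⊎ (s ≡ b × t ≡ a)
addEdge-adj⁻ G a b s t e with ∨-true⁻ {adj G s t} e
... | inj₁ x = inj₁ x
... | inj₂ y with ∨-true⁻ {(s ≡ᵇ a) ∧ (t ≡ᵇ b)} y
... | inj₁ z = inj₂ (inj₁ (≡ᵇ-true (∧-true⁻ˡ z) , ≡ᵇ-true (∧-true⁻ʳ z)))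
... | inj₂ z = inj₂ (inj₂ (≡ᵇ-true (∧-true⁻ˡ z) , ≡ᵇ-true (∧-true⁻ʳ z)))

addEdge-adj⁺ : ∀ G a b s t → adj G s t ≡ true → adj (addEdge G a b) s t ≡ true
addEdge-adj⁺ G a b s t e = ∨-true⁺ˡ e

addEdge-ab : ∀ G a b → adj (addEdge G a b) a b ≡ true
addEdge-ab G a b = ∨-true⁺ʳ {adj G a b} (∨-true⁺ˡ (∧-true⁺ (≡ᵇ-refl a) (≡ᵇ-refl b)))

addEdge-ba : ∀ G a b → adj (addEdge G a b) b a ≡ true
addEdge-ba G a b = ∨-true⁺ʳ {adj G b a} (∨-true⁺ʳ {(b ≡ᵇ a) ∧ (a ≡ᵇ b)} (∧-true⁺ (≡ᵇ-refl b) (≡ᵇ-refl a)))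

addEdge-adj-other : ∀ G a b s t → s ≢ a → s ≢ b → adj (addEdge G a b) s t ≡ adj G s t
addEdge-adj-other G a b s t n1 n2 rewrite ≡ᵇ-false n1 | ≡ᵇ-false n2 = trans (cong (adj G s t ∨_) refl) (∨-identityʳ (adj G s t))

Symm : Graph → Set
Symm G = ∀ u v → adj G u v ≡ adj G v u

uniq-deleteVertex : ∀ G x → Unique (V G) → Unique (V (deleteVertex G x))
uniq-deleteVertex G x u = uniq-filter (λ a → not (a ≡ᵇ x)) (V G) u

deleteVertex-adj-pointwise : ∀ G x z b → z ≢ x → b ≢ x →
  (not (b ≡ᵇ x) ∧ (adj G z b ∧ not (z ≡ᵇ x) ∧ not (b ≡ᵇ x))) ≡ adj G z b
deleteVertex-adj-pointwise G x z b n1 n2 rewrite ≡ᵇ-false n1 | ≡ᵇ-false n2 = ∧-identityʳ (adj G z b)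

deg-deleteVertex-nonadjacent : ∀ G x z → z ≢ x → adj G z x ≡ false → deg (deleteVertex G x) z ≡ deg G z
deg-deleteVertex-nonadjacent G x z nz f =
  trans (length-filter-filter (adj (deleteVertex G x) z) (λ a → not (a ≡ᵇ x)) (V G))
        (length-filter-cong _ (adj G z) (V G) pt)
  where
  pt : ∀ b → b ∈ V G → (not (b ≡ᵇ x) ∧ (adj G z b ∧ not (z ≡ᵇ x) ∧ not (b ≡ᵇ x))) ≡ adj G z b
  pt b _ with ≡ᵇ-view b x
  ... | isEq e refl rewrite e = sym f
  ... | isNe e ne = deleteVertex-adj-pointwise G x z b nz ne

deg-deleteVertex-adjacent : ∀ G x z → Unique (V G) → x ∈ V G → z ≢ x → adj G z x ≡ true →
  deg G z ≡ suc (deg (deleteVertex G x) z)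
deg-deleteVertex-adjacent G x z u m nz t =
  trans (length-filter-suc (λ b → not (b ≡ᵇ x) ∧ (adj G z b ∧ not (z ≡ᵇ x) ∧ not (b ≡ᵇ x))) (adj G z) (V G) x u m
          pf t (λ b _ nb → deleteVertex-adj-pointwise G x z b nz nb))
        (cong suc (sym (length-filter-filter (adj (deleteVertex G x) z) (λ a → not (a ≡ᵇ x)) (V G))))
  where
  pf : (not (x ≡ᵇ x) ∧ (adj G z x ∧ not (z ≡ᵇ x) ∧ not (x ≡ᵇ x))) ≡ false
  pf rewrite ≡ᵇ-refl x = refl

deg-deleteEdge-other : ∀ G u v z → z ≢ u → z ≢ v → deg (deleteEdge G u v) z ≡ deg G z
deg-deleteEdge-other G u v z n1 n2 = length-filter-cong _ (adj G z) (V G) pt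
  where
  pt : ∀ b → b ∈ V G → (adj G z b ∧ not (((z ≡ᵇ u) ∧ (b ≡ᵇ v)) ∨ ((z ≡ᵇ v) ∧ (b ≡ᵇ u)))) ≡ adj G z b
  pt b _ rewrite ≡ᵇ-false n1 | ≡ᵇ-false n2 = ∧-identityʳ (adj G z b)

deg-deleteEdge-endˡ : ∀ G u v → Unique (V G) → u ≢ v → v ∈ V G → adj G u v ≡ true →
  deg G u ≡ suc (deg (deleteEdge G u v) u)
deg-deleteEdge-endˡ G u v uV ne m t = length-filter-suc _ (adj G u) (V G) v uV m pf t pt
  where
  pf : (adj G u v ∧ not (((u ≡ᵇ u) ∧ (v ≡ᵇ v)) ∨ ((u ≡ᵇ v) ∧ (v ≡ᵇ u)))) ≡ false
  pf rewrite ≡ᵇ-refl u | ≡ᵇ-refl v | t = refl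
  pt : ∀ b → b ∈ V G → b ≢ v → (adj G u b ∧ not (((u ≡ᵇ u) ∧ (b ≡ᵇ v)) ∨ ((u ≡ᵇ v) ∧ (b ≡ᵇ u)))) ≡ adj G u b
  pt b _ nb rewrite ≡ᵇ-refl u | ≡ᵇ-false nb | ≡ᵇ-false ne = ∧-identityʳ (adj G u b)

deg-deleteEdge-endʳ : ∀ G u v → Unique (V G) → u ≢ v → u ∈ V G → adj G v u ≡ true →
  deg G v ≡ suc (deg (deleteEdge G u v) v)
deg-deleteEdge-endʳ G u v uV ne m t = length-filter-suc _ (adj G v) (V G) u uV m pf t pt
  where
  ne2 : v ≢ u
  ne2 e = ne (sym e)
  pf : (adj G v u ∧ not (((v ≡ᵇ u) ∧ (u ≡ᵇ v)) ∨ ((v ≡ᵇ v) ∧ (u ≡ᵇ u)))) ≡ false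
  pf rewrite ≡ᵇ-refl u | ≡ᵇ-refl v | t | ≡ᵇ-false ne2 = refl
  pt : ∀ b → b ∈ V G → b ≢ u → (adj G v b ∧ not (((v ≡ᵇ u) ∧ (b ≡ᵇ v)) ∨ ((v ≡ᵇ v) ∧ (b ≡ᵇ u)))) ≡ adj G v b
  pt b _ nb rewrite ≡ᵇ-refl v | ≡ᵇ-false nb | ≡ᵇ-false ne2 = ∧-identityʳ (adj G v b)

deg-addEdge-other : ∀ G a b z → z ≢ a → z ≢ b → deg (addEdge G a b) z ≡ deg G z
deg-addEdge-other G a b z n1 n2 = length-filter-cong _ (adj G z) (V G) (λ t _ → addEdge-adj-other G a b z t n1 n2)

deg-addEdge-endˡ : ∀ G a b → Unique (V G) → a ≢ b → b ∈ V G → adj G a b ≡ false →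
  deg (addEdge G a b) a ≡ suc (deg G a)
deg-addEdge-endˡ G a b uV ne m f = length-filter-suc (adj G a) _ (V G) b uV m f (addEdge-ab G a b) pt
  where
  pt : ∀ t → t ∈ V G → t ≢ b → adj G a t ≡ (adj G a t ∨ ((a ≡ᵇ a) ∧ (t ≡ᵇ b)) ∨ ((a ≡ᵇ b) ∧ (t ≡ᵇ a)))
  pt t _ nt rewrite ≡ᵇ-refl a | ≡ᵇ-false nt | ≡ᵇ-false ne = sym (∨-identityʳ (adj G a t))

deg-addEdge-endʳ : ∀ G a b → Unique (V G) → a ≢ b → a ∈ V G → adj G b a ≡ false →
  deg (addEdge G a b) b ≡ suc (deg G b)
deg-addEdge-endʳ G a b uV ne m f = length-filter-suc (adj G b) _ (V G) a uV m f (addEdge-ba G a b) pt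
  where
  ne2 : b ≢ a
  ne2 e = ne (sym e)
  pt : ∀ t → t ∈ V G → t ≢ a → adj G b t ≡ (adj G b t ∨ ((b ≡ᵇ a) ∧ (t ≡ᵇ b)) ∨ ((b ≡ᵇ b) ∧ (t ≡ᵇ a)))
  pt t _ nt rewrite ≡ᵇ-refl b | ≡ᵇ-false nt | ≡ᵇ-false ne2 = sym (∨-identityʳ (adj G b t))

suppress-unfold : ∀ H w a b → neighbours H w ≡ a ∷ b ∷ [] → suppress H w ≡ addEdge (deleteVertex H w) a b
suppress-unfold H w a b e rewrite e = refl

record SimpleConnected (G : Graph) : Set where
  field
    uniqueV   : Unique (V G)
    symmetric : Symm G
    irrefl    : ∀ u → adj G u u ≡ false
    inV       : ∀ u v → adj G u v ≡ true → u ∈ V G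
    connected : Connected G

deg-suppress : ∀ H w → SimpleConnected H → (d : Deg2 H w) → adj H (Deg2.a d) (Deg2.b d) ≡ false →
  ∀ z → z ≢ w → deg (suppress H w) z ≡ deg H z
deg-suppress H w pn (mkDeg2 a b eqn aN bN ab only) fab z nz
  rewrite suppress-unfold H w a b eqn = cases
  where
  open SimpleConnected pn
  H1 = deleteVertex H w
  aw : a ≢ w
  aw refl = true≢false (trans (sym (nbrAdj aN)) (irrefl a))
  bw : b ≢ w
  bw refl = true≢false (trans (sym (nbrAdj bN)) (irrefl b))
  uV1 : Unique (V H1)
  uV1 = uniq-deleteVertex H w uniqueV
  wV : w ∈ V H
  wV = inV w a (nbrAdj aN)
  cases : deg (addEdge H1 a b) z ≡ deg H z
  cases with ≡ᵇ-view z a | ≡ᵇ-view z b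
  ... | isEq _ refl | _ = trans (deg-addEdge-endˡ H1 a b uV1 ab (deleteVertex-V⁺ H w b (nbrV bN) bw) (deleteVertex-adj-false H w a b fab))
                          (sym (deg-deleteVertex-adjacent H w a uniqueV wV aw (trans (symmetric a w) (nbrAdj aN))))
  ... | isNe _ _ | isEq _ refl = trans (deg-addEdge-endʳ H1 a b uV1 ab (deleteVertex-V⁺ H w a (nbrV aN) aw)
                                   (deleteVertex-adj-false H w b a (trans (symmetric b a) fab)))
                          (sym (deg-deleteVertex-adjacent H w b uniqueV wV bw (trans (symmetric b w) (nbrAdj bN))))
  ... | isNe _ n1 | isNe _ n2 = trans (deg-addEdge-other H1 a b z n1 n2) (deg-deleteVertex-nonadjacent H w z nz zw)
    where
    zw : adj H z w ≡ false
    zw with adj H z w in e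
    ... | false = refl
    ... | true with inV z w e
    ... | zV with only z (mkNbr zV (trans (symmetric w z) e))
    ... | inj₁ x = ⊥-elim (n1 x)
    ... | inj₂ y = ⊥-elim (n2 y)

walk-start : ∀ {G a b} → Walk G a b → a ∈ V G
walk-start (here m) = m
walk-start (step m _ _) = m

walk-app : ∀ {G a b c} → Walk G a b → Walk G b c → Walk G a c
walk-app (here _) w2 = w2
walk-app (step m e w) w2 = step m e (walk-app w w2)

walk-rev : ∀ {G a b} → Symm G → Walk G a b → Walk G b a
walk-rev sy (here m) = here m
walk-rev {G} sy (step {u} {w} m e wk) =
  walk-app (walk-rev sy wk) (step (walk-start wk) (trans (sy w u) e) (here m))

walk-map : ∀ {G G2} (f : ℕ → ℕ) → (∀ z → z ∈ V G → f z ∈ V G2) →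
  (∀ s t → s ∈ V G → adj G s t ≡ true → Walk G2 (f s) (f t)) →
  ∀ {a b} → Walk G a b → Walk G2 (f a) (f b)
walk-map f hV hE (here m) = here (hV _ m)
walk-map f hV hE (step m e w) = walk-app (hE _ _ m e) (walk-map f hV hE w)

edge-walk : ∀ {G s t} → s ∈ V G → t ∈ V G → adj G s t ≡ true → Walk G s t
edge-walk m1 m2 e = step m1 e (here m2)

conn-map : ∀ G G2 (f : ℕ → ℕ) → Connected G →
  (∀ z → z ∈ V G → f z ∈ V G2) →
  (∀ s t → s ∈ V G → adj G s t ≡ true → Walk G2 (f s) (f t)) →
  (∀ z → z ∈ V G2 → z ∈ V G) → (∀ z → z ∈ V G2 → f z ≡ z) → Connected G2
conn-map G G2 f c hV hE sub fid u v mu mv =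
  subst₂ (fid u mu) (fid v mv) (walk-map f hV hE (c u v (sub u mu) (sub v mv)))
  where
  subst₂ : ∀ {a b a2 b2} → a ≡ a2 → b ≡ b2 → Walk G2 a b → Walk G2 a2 b2
  subst₂ refl refl w = w

bool-ext : ∀ {b1 b2 : Bool} → (b1 ≡ true → b2 ≡ true) → (b2 ≡ true → b1 ≡ true) → b1 ≡ b2
bool-ext {true} f g = sym (f refl)
bool-ext {false} {false} f g = refl
bool-ext {false} {true} f g = g refl

symmetric-deleteEdge : ∀ G u v → Symm G → Symm (deleteEdge G u v)
symmetric-deleteEdge G u v sy s t = bool-ext (sw s t) (sw t s)
  where
  sw : ∀ s t → adj (deleteEdge G u v) s t ≡ true → adj (deleteEdge G u v) t s ≡ true
  sw s t e = let (a , b , c) = deleteEdge-adj⁻ G u v s t e in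
    deleteEdge-adj⁺ G u v t s (trans (sy t s) a) (λ (p , q) → c (q , p)) (λ (p , q) → b (q , p))

InV : Graph → Set
InV G = ∀ u v → adj G u v ≡ true → u ∈ V G

inV-target : ∀ {G} → InV G → Symm G → ∀ s t → adj G s t ≡ true → t ∈ V G
inV-target iv sy s t e = iv t s (trans (sy t s) e)

≟-pair : ∀ (s t c d : ℕ) → Dec (s ≡ c × t ≡ d)
≟-pair s t c d with s ≟ c | t ≟ d
... | yes p | yes q = yes (p , q)
... | no p | _ = no (λ (x , _) → p x)
... | yes _ | no q = no (λ (_ , y) → q y)

bypass-connected : ∀ G c d → Connected G → Symm G → InV G → Walk (deleteEdge G c d) c d → Connected (deleteEdge G c d)
bypass-connected G c d con sy iv w = conn-map G (deleteEdge G c d) (λ z → z) con (λ z m → m) hE (λ z m → m) (λ z m → refl)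
  where
  hE : ∀ s t → s ∈ V G → adj G s t ≡ true → Walk (deleteEdge G c d) s t
  hE s t m e with ≟-pair s t c d | ≟-pair s t d c
  ... | yes (refl , refl) | _ = w
  ... | no _ | yes (refl , refl) = walk-rev (symmetric-deleteEdge G c d sy) w
  ... | no n1 | no n2 = edge-walk m (inV-target iv sy s t e) (deleteEdge-adj⁺ G c d s t e n1 n2)

cut-edge-no-bypass : ∀ G c d → Connected G → Symm G → InV G → CutEdge G c d → Walk (deleteEdge G c d) c d → ⊥
cut-edge-no-bypass G c d con sy iv (_ , nc) w = nc (bypass-connected G c d con sy iv w)

pendant-edge-cut : ∀ G p x → adj G p x ≡ true → (∀ z → adj G x z ≡ true → z ≡ p) → x ≢ p → x ∈ V G → p ∈ V G →
  CutEdge G p x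
pendant-edge-cut G p x e only ne mx mp = e , λ con → f (con x p (dv mx) (dv mp))
  where
  dv : ∀ {z} → z ∈ V G → z ∈ V (deleteEdge G p x)
  dv m = m
  f : Walk (deleteEdge G p x) x p → ⊥
  f (here _) = ne refl
  f (step {w = w} _ a _) with deleteEdge-adj⁻ G p x x w a
  ... | a1 , n1 , n2 = n2 (refl , only w a1)

-- Simple paths and cycles

lastOf : ℕ → List ℕ → ℕ
lastOf a [] = a
lastOf a (b ∷ L) = lastOf b L

lastOf-∈ : ∀ a L → lastOf a L ∈ a ∷ L
lastOf-∈ a [] = here refl
lastOf-∈ a (b ∷ L) = there (lastOf-∈ b L)

lastOf-++ : ∀ x X y Y → lastOf x (X ++ y ∷ Y) ≡ lastOf y Y
lastOf-++ x [] y Y = refl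
lastOf-++ x (z ∷ X) y Y = lastOf-++ z X y Y

lastOf-snoc : ∀ x X y → lastOf x (X ++ y ∷ []) ≡ y
lastOf-snoc x X y = lastOf-++ x X y []

head-∈-prefix : ∀ {s x : ℕ} {rest} R1 {R2} → s ∷ rest ≡ R1 ++ x ∷ R2 → s ∈ R1 ⊎ s ≡ x
head-∈-prefix [] refl = inj₂ refl
head-∈-prefix (y ∷ R1) refl = inj₁ (here refl)

snoc≢[] : ∀ (X : List ℕ) a → X ++ a ∷ [] ≢ []
snoc≢[] [] a ()
snoc≢[] (x ∷ X) a ()

∈++ : ∀ {z : ℕ} X Y → z ∈ X ++ Y → z ∈ X ⊎ z ∈ Y
∈++ X Y m = ∈-++⁻ X m

∈++l : ∀ {z : ℕ} X Y → z ∈ X → z ∈ X ++ Y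
∈++l X Y m = ∈-++⁺ˡ m

∈++r : ∀ {z : ℕ} X Y → z ∈ Y → z ∈ X ++ Y
∈++r X Y m = ∈-++⁺ʳ X m

Disj : List ℕ → List ℕ → Set
Disj X Y = ∀ z → z ∈ X → z ∈ Y → ⊥

uniq++⁻ : ∀ X Y → Unique (X ++ Y) → Unique X × Unique Y × Disj X Y
uniq++⁻ [] Y u = uniq-nil , u , λ z ()
uniq++⁻ (x ∷ X) Y u with uniq++⁻ X Y (uniq-tail u)
... | a , b , c = uniq-cons (λ m → uniq-head u (∈++l X Y m)) a , b , d
  where
  d : Disj (x ∷ X) Y
  d z (here refl) m2 = uniq-head u (∈++r X Y m2)
  d z (there m1) m2 = c z m1 m2

uniq++⁺ : ∀ X Y → Unique X → Unique Y → Disj X Y → Unique (X ++ Y)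
uniq++⁺ [] Y ux uy d = uy
uniq++⁺ (x ∷ X) Y ux uy d = uniq-cons nm (uniq++⁺ X Y (uniq-tail ux) uy (λ z m1 m2 → d z (there m1) m2))
  where
  nm : x ∉ X ++ Y
  nm m with ∈++ X Y m
  ... | inj₁ m1 = uniq-head ux m1
  ... | inj₂ m2 = d x (here refl) m2

∈-swap++ : ∀ {z : ℕ} X Y → z ∈ X ++ Y → z ∈ Y ++ X
∈-swap++ X Y m with ∈++ X Y m
... | inj₁ m1 = ∈++r Y X m1
... | inj₂ m2 = ∈++l Y X m2

uniq-swap : ∀ X Y → Unique (X ++ Y) → Unique (Y ++ X)
uniq-swap X Y u with uniq++⁻ X Y u
... | a , b , c = uniq++⁺ Y X b a (λ z m1 m2 → c z m2 m1)

chain-tail : ∀ {G x X} → ChainAdj G (x ∷ X) → ChainAdj G X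
chain-tail {X = []} c = tt
chain-tail {X = y ∷ X} (_ , c) = c

chain-++l : ∀ {G} X Y → ChainAdj G (X ++ Y) → ChainAdj G X
chain-++l [] Y c = tt
chain-++l (x ∷ []) Y c = tt
chain-++l (x ∷ y ∷ X) Y (e , c) = e , chain-++l (y ∷ X) Y c

chain-++r : ∀ {G} X Y → ChainAdj G (X ++ Y) → ChainAdj G Y
chain-++r [] Y c = c
chain-++r (x ∷ X) Y c = chain-++r X Y (chain-tail {x = x} {X = X ++ Y} c)

chain-junction : ∀ {G} x X y Y → ChainAdj G (x ∷ X ++ y ∷ Y) → adj G (lastOf x X) y ≡ true
chain-junction x [] y Y (e , _) = e
chain-junction x (z ∷ X) y Y (_ , c) = chain-junction z X y Y c

chain-++ : ∀ {G} x X y Y → ChainAdj G (x ∷ X) → ChainAdj G (y ∷ Y) → adj G (lastOf x X) y ≡ true →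
  ChainAdj G (x ∷ X ++ y ∷ Y)
chain-++ x [] y Y c1 c2 e = e , c2
chain-++ x (z ∷ X) y Y (e1 , c1) c2 e = e1 , chain-++ z X y Y c1 c2 e

chain-walk : ∀ {G} a L → ChainAdj G (a ∷ L) → (∀ z → z ∈ a ∷ L → z ∈ V G) → Walk G a (lastOf a L)
chain-walk a [] c h = here (h a (here refl))
chain-walk a (b ∷ L) (e , c) h = step (h a (here refl)) e (chain-walk b L c (λ z m → h z (there m)))

chain-mono : ∀ {G H} L → (∀ s t → s ∈ L → t ∈ L → adj G s t ≡ true → adj H s t ≡ true) → ChainAdj G L → ChainAdj H L
chain-mono [] h c = tt
chain-mono (x ∷ []) h c = tt
chain-mono (x ∷ y ∷ L) h (e , c) = h x y (here refl) (there (here refl)) e ,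
  chain-mono (y ∷ L) (λ s t m1 m2 → h s t (there m1) (there m2)) c

chain-del : ∀ {G} c d L → c ∉ L → ChainAdj G L → ChainAdj (deleteEdge G c d) L
chain-del c d [] n ch = tt
chain-del c d (x ∷ []) n ch = tt
chain-del {G} c d (x ∷ y ∷ L) n (e , ch) =
  deleteEdge-adj⁺ G c d x y e (λ (p , _) → n (here (sym p))) (λ (_ , q) → n (there (here (sym q)))) ,
  chain-del c d (y ∷ L) (λ m → n (there m)) ch

record SimplePath (G : Graph) (L : List ℕ) : Set where
  constructor mkSP
  field
    spV : ∀ z → z ∈ L → z ∈ V G
    spU : Unique L
    spC : ChainAdj G L
open SimplePath public

sp-suffix : ∀ {G} X Y → SimplePath G (X ++ Y) → SimplePath G Y
sp-suffix X Y (mkSP h u c) = mkSP (λ z m → h z (∈++r X Y m)) (proj₁ (proj₂ (uniq++⁻ X Y u))) (chain-++r X Y c)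

sp-prefix : ∀ {G} X Y → SimplePath G (X ++ Y) → SimplePath G X
sp-prefix X Y (mkSP h u c) = mkSP (λ z m → h z (∈++l X Y m)) (proj₁ (uniq++⁻ X Y u)) (chain-++l X Y c)

sp-tail : ∀ {G x} L → SimplePath G (x ∷ L) → SimplePath G L
sp-tail {x = x} L sp = sp-suffix (x ∷ []) L sp

sp-cons : ∀ {G} w x L → SimplePath G (x ∷ L) → w ∉ x ∷ L → w ∈ V G → adj G w x ≡ true → SimplePath G (w ∷ x ∷ L)
sp-cons {G} w x L (mkSP h u c) nm mw e = mkSP h2 (uniq-cons nm u) (e , c)
  where
  h2 : ∀ z → z ∈ w ∷ x ∷ L → z ∈ V G
  h2 z (here refl) = mw
  h2 z (there m) = h z m

rev : List ℕ → List ℕ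
rev [] = []
rev (x ∷ L) = rev L ++ x ∷ []

∈-rev⁺ : ∀ {z} L → z ∈ L → z ∈ rev L
∈-rev⁺ (x ∷ L) (here refl) = ∈++r (rev L) (x ∷ []) (here refl)
∈-rev⁺ (x ∷ L) (there m) = ∈++l (rev L) (x ∷ []) (∈-rev⁺ L m)

∈-rev⁻ : ∀ {z} L → z ∈ rev L → z ∈ L
∈-rev⁻ (x ∷ L) m with ∈++ (rev L) (x ∷ []) m
... | inj₁ m1 = there (∈-rev⁻ L m1)
... | inj₂ (here refl) = here refl

uniq-reverse : ∀ L → Unique L → Unique (rev L)
uniq-reverse [] u = uniq-nil
uniq-reverse (x ∷ L) u = uniq++⁺ (rev L) (x ∷ []) (uniq-reverse L (uniq-tail u)) (uniq-cons (λ ()) uniq-nil)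
  (λ { z m1 (here refl) → uniq-head u (∈-rev⁻ L m1) })

snoc-last : ∀ (K : List ℕ) y h T → K ++ y ∷ [] ≡ h ∷ T → lastOf h T ≡ y
snoc-last [] y h T refl = refl
snoc-last (k ∷ K) y h T refl = lastOf-snoc k K y

chain-snoc : ∀ {G} K x → ChainAdj G K → (∀ h T → K ≡ h ∷ T → adj G (lastOf h T) x ≡ true) → ChainAdj G (K ++ x ∷ [])
chain-snoc [] x c f = tt
chain-snoc (k ∷ K) x c f = chain-++ k K x [] c tt (f k K refl)

chain-reverse : ∀ {G} → Symm G → ∀ L → ChainAdj G L → ChainAdj G (rev L)
chain-reverse sy [] c = tt
chain-reverse sy (x ∷ []) c = tt
chain-reverse {G} sy (x ∷ y ∷ L) (e , c) = chain-snoc (rev (y ∷ L)) x (chain-reverse sy (y ∷ L) c)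
  (λ h T eq → subst (λ q → adj G q x ≡ true) (sym (snoc-last (rev L) y h T eq)) (trans (sy y x) e))

simplePath-reverse : ∀ {G} → Symm G → ∀ L → SimplePath G L → SimplePath G (rev L)
simplePath-reverse sy L (mkSP h u c) = mkSP (λ z m → h z (∈-rev⁻ L m)) (uniq-reverse L u) (chain-reverse sy L c)

simplePath-length≤ : ∀ {G} L → Unique (V G) → SimplePath G L → length L ≤ length (V G)
simplePath-length≤ L uV sp = unique-sub-length≤ L _ (spU sp) (spV sp)

record SimpleCycle (G : Graph) (c : ℕ) (ws : List ℕ) : Set where
  constructor mkCyc
  field
    cyP : SimplePath G (c ∷ ws)
    cyL : 2 ≤ length ws
    cyE : adj G (lastOf c ws) c ≡ true
open SimpleCycle public

SimpleCycle⇒Cycle : ∀ {G c ws} → SimpleCycle G c ws → Cycle G c ws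
SimpleCycle⇒Cycle {c = c} {ws} (mkCyc (mkSP h u ch) l e) = h , u , l , chain-++ c ws c [] ch tt e

Cycle⇒SimpleCycle : ∀ {G c ws} → Cycle G c ws → SimpleCycle G c ws
Cycle⇒SimpleCycle {c = c} {ws} (h , u , l , ch) = mkCyc (mkSP h u (chain-++l (c ∷ ws) (c ∷ []) ch)) l (chain-junction c ws c [] ch)

length-rotate : ∀ (A B : List ℕ) (z c : ℕ) → length (A ++ z ∷ B) ≡ length (B ++ c ∷ A)
length-rotate A B z c rewrite length-++ A {z ∷ B} | length-++ B {c ∷ A} | +-suc (length A) (length B) | +-suc (length B) (length A) | +-comm (length A) (length B) = refl

cycle-rotate : ∀ {G} c A z B → SimpleCycle G c (A ++ z ∷ B) → SimpleCycle G z (B ++ c ∷ A)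
cycle-rotate {G} c A z B (mkCyc (mkSP h u ch) l e) = mkCyc (mkSP h2 u2 ch2) l2 e2
  where
  h2 : ∀ y → y ∈ z ∷ B ++ c ∷ A → y ∈ V G
  h2 y m = h y (∈-swap++ (z ∷ B) (c ∷ A) m)
  u2 : Unique (z ∷ B ++ c ∷ A)
  u2 = uniq-swap (c ∷ A) (z ∷ B) u
  l2 : 2 ≤ length (B ++ c ∷ A)
  l2 = subst (2 ≤_) (length-rotate A B z c) l
  lastEq : lastOf c (A ++ z ∷ B) ≡ lastOf z B
  lastEq = lastOf-++ c A z B
  ch2 : ChainAdj G (z ∷ B ++ c ∷ A)
  ch2 = chain-++ z B c A (chain-++r (c ∷ A) (z ∷ B) ch) (chain-++l (c ∷ A) (z ∷ B) ch)
          (subst (λ q → adj G q c ≡ true) lastEq e)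
  e2 : adj G (lastOf z (B ++ c ∷ A)) z ≡ true
  e2 = subst (λ q → adj G q z ≡ true) (sym (lastOf-++ z B c A)) (chain-junction c A z B ch)

cycle-rebase : ∀ {G c ws z} → SimpleCycle G c ws → z ∈ c ∷ ws → Σ (List ℕ) λ ws2 → SimpleCycle G z ws2 ×
  (∀ y → y ∈ z ∷ ws2 → y ∈ c ∷ ws) × (∀ y → y ∈ c ∷ ws → y ∈ z ∷ ws2)
cycle-rebase {G} {c} {ws} {z} cy (here refl) = ws , cy , (λ y m → m) , (λ y m → m)
cycle-rebase {G} {c} {ws} {z} cy (there m) with ∈-∃++ m
... | A , B , refl = B ++ c ∷ A , cycle-rotate c A z B cy , (λ y → ∈-swap++ (z ∷ B) (c ∷ A)) , (λ y → ∈-swap++ (c ∷ A) (z ∷ B))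

cycle-base-two-neighbours : ∀ {G c ws} → Symm G → SimpleCycle G c ws → Σ ℕ λ z1 → Σ ℕ λ z2 → z1 ≢ z2 × adj G c z1 ≡ true × adj G c z2 ≡ true
  × z1 ∈ c ∷ ws × z2 ∈ c ∷ ws
cycle-base-two-neighbours {G} {c} {w1 ∷ w2 ∷ ws} sy (mkCyc (mkSP h u (e , ch)) l e2) =
  w1 , lastOf w2 ws , ne , e , trans (sy c _) e2 , there (here refl) , there (there (lastOf-∈ w2 ws))
  where
  ne : w1 ≢ lastOf w2 ws
  ne q = uniq-head (uniq-tail u) (subst (_∈ w2 ∷ ws) (sym q) (lastOf-∈ w2 ws))
cycle-base-two-neighbours {G} {c} {w1 ∷ []} sy (mkCyc _ (s≤s ()) _)

cycle-two-neighbours : ∀ {G c ws z} → Symm G → SimpleCycle G c ws → z ∈ c ∷ ws →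
  Σ ℕ λ z1 → Σ ℕ λ z2 → z1 ≢ z2 × adj G z z1 ≡ true × adj G z z2 ≡ true × z1 ∈ c ∷ ws × z2 ∈ c ∷ ws
cycle-two-neighbours sy cy m with cycle-rebase cy m
... | ws2 , cy2 , f , _ with cycle-base-two-neighbours sy cy2
... | z1 , z2 , ne , e1 , e2 , m1 , m2 = z1 , z2 , ne , e1 , e2 , f z1 m1 , f z2 m2

unique-neighbour-off-cycle : ∀ {G c ws z p} → Symm G → SimpleCycle G c ws → z ∈ c ∷ ws → (∀ t → adj G z t ≡ true → t ≡ p) → ⊥
unique-neighbour-off-cycle sy cy m only with cycle-two-neighbours sy cy m
... | z1 , z2 , ne , e1 , e2 , _ = ne (trans (only _ e1) (sym (only _ e2)))

-- Edges between vertices of a cycle are not cut-edges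

walk-de-swap : ∀ {G u v a b} → Walk (deleteEdge G u v) a b → Walk (deleteEdge G v u) a b
walk-de-swap (here m) = here m
walk-de-swap {G} {u} {v} (step {a} {w} m e wk) with deleteEdge-adj⁻ G u v a w e
... | e′ , n₁ , n₂ = step m (deleteEdge-adj⁺ G v u a w e′ n₂ n₁) (walk-de-swap wk)

path-avoids-edge : ∀ {G} c m M d → SimplePath G (c ∷ m ∷ M ++ d ∷ []) → Walk (deleteEdge G c d) c d
path-avoids-edge {G} c m M d (mkSP hV u (e , ch)) =
  step (hV c (here refl)) first (subst (Walk (deleteEdge G c d) m) (lastOf-snoc m M d) along)
  where
  first : adj (deleteEdge G c d) c m ≡ true
  first = deleteEdge-adj⁺ G c d c m e (λ (_ , m≡d) → uniq-head (uniq-tail u) (subst (_∈ M ++ d ∷ []) (sym m≡d) (∈-insert M)))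
                              (λ (_ , m≡c) → uniq-head u (here (sym m≡c)))
  along : Walk (deleteEdge G c d) m (lastOf m (M ++ d ∷ []))
  along = chain-walk m (M ++ d ∷ []) (chain-del c d (m ∷ M ++ d ∷ []) (uniq-head u) ch) (λ z mz → hV z (there mz))

cycle-chord-bypass : ∀ {G c ws d} → Symm G → SimpleCycle G c ws → d ∈ ws → Walk (deleteEdge G c d) c d
cycle-chord-bypass {G} {c} {ws} {d} sy cy m with ∈-∃++ m
... | a ∷ A , B , refl =
  path-avoids-edge c a A d (sp-prefix (c ∷ a ∷ A ++ d ∷ []) B
    (subst (SimplePath G) (cong (λ q → c ∷ a ∷ q) (sym (++-assoc A (d ∷ []) B))) (cyP cy)))
... | [] , [] , refl with cyL cy
... | s≤s ()
cycle-chord-bypass {G} {c} {ws} {d} sy cy m | [] , b ∷ B , refl =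
  walk-rev (symmetric-deleteEdge G c d sy) (walk-de-swap (path-avoids-edge d b B c (cyP (cycle-rotate c [] d (b ∷ B) cy))))

cycle-bypass : ∀ {G c ws u v} → Symm G → SimpleCycle G c ws → u ∈ c ∷ ws → v ∈ c ∷ ws → u ≢ v → Walk (deleteEdge G u v) u v
cycle-bypass sy cy mu mv ne with cycle-rebase cy mu
... | ws2 , cy2 , f , g with g _ mv
... | here e = ⊥-elim (ne (sym e))
... | there m = cycle-chord-bypass sy cy2 m

cycle-edge-not-cut : ∀ {G c ws z d} → Connected G → Symm G → InV G → SimpleCycle G c ws → z ∈ c ∷ ws → d ∈ c ∷ ws →
  z ≢ d → CutEdge G z d → ⊥
cycle-edge-not-cut con sy iv cy mz md ne cut = cut-edge-no-bypass _ _ _ con sy iv cut (cycle-bypass sy cy mz md ne)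

path-closing-cycle : ∀ {G} → Symm G → ∀ h K x R → 1 ≤ length K → SimplePath G (h ∷ K ++ x ∷ R) → adj G h x ≡ true →
  SimpleCycle G h (K ++ x ∷ [])
path-closing-cycle {G} sy h K x R K≢[] sp e = mkCyc prefix long closing
  where
  prefix : SimplePath G (h ∷ K ++ x ∷ [])
  prefix = sp-prefix (h ∷ K ++ x ∷ []) R (subst (SimplePath G) (cong (h ∷_) (sym (++-assoc K (x ∷ []) R))) sp)
  long : 2 ≤ length (K ++ x ∷ [])
  long = subst (2 ≤_) (sym (trans (length-++ K) (+-comm (length K) 1))) (s≤s K≢[])
  closing : adj G (lastOf h (K ++ x ∷ [])) h ≡ true
  closing = subst (λ q → adj G q h ≡ true) (sym (lastOf-snoc h K x)) (trans (sy x h) e)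

no-cut-between-path-vertices : ∀ G X c m M c2 Y → Connected G → Symm G → InV G →
  SimplePath G (X ++ c ∷ m ∷ M ++ c2 ∷ Y) → CutEdge G c c2 → ⊥
no-cut-between-path-vertices G X c m M c2 Y con sy iv sp cut = cut-edge-no-bypass G c c2 con sy iv cut (path-avoids-edge c m M c2 sub)
  where
  sub : SimplePath G (c ∷ m ∷ M ++ c2 ∷ [])
  sub = sp-prefix (c ∷ m ∷ M ++ c2 ∷ []) Y
          (subst (SimplePath G) (cong (λ q → c ∷ m ∷ q) (sym (++-assoc M (c2 ∷ []) Y))) (sp-suffix X _ sp))

-- Deleting a leaf or a cycle edge, and suppressing a vertex

connected-extend : ∀ H1 H2 → Connected H1 → (∀ z → z ∈ V H1 → z ∈ V H2) →
  (∀ s t → s ∈ V H1 → adj H1 s t ≡ true → Walk H2 s t) →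
  (∀ z → z ∈ V H2 → z ∈ V H1 ⊎ Σ ℕ λ w → w ∈ V H1 × Walk H2 z w) → Symm H2 → Connected H2
connected-extend H1 H2 c sub hE cover sy u v mu mv with cover u mu | cover v mv
... | inj₁ a | inj₁ b = wm (c u v a b)
  where
  wm : ∀ {x y} → Walk H1 x y → Walk H2 x y
  wm = walk-map (λ z → z) sub hE
... | inj₁ a | inj₂ (w , mw , wk) = walk-app (walk-map (λ z → z) sub hE (c u w a mw)) (walk-rev sy wk)
... | inj₂ (w , mw , wk) | inj₁ b = walk-app wk (walk-map (λ z → z) sub hE (c w v mw b))
... | inj₂ (w1 , mw1 , wk1) | inj₂ (w2 , mw2 , wk2) =
  walk-app wk1 (walk-app (walk-map (λ z → z) sub hE (c w1 w2 mw1 mw2)) (walk-rev sy wk2))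

-- Collapsing a deleted vertex x onto a neighbour p maps walks of the old graph to walks of the new one.

redirect : ℕ → ℕ → ℕ → ℕ
redirect x p z = if z ≡ᵇ x then p else z

redirect-self : ∀ x p → redirect x p x ≡ p
redirect-self x p rewrite ≡ᵇ-refl x = refl

redirect-other : ∀ x p z → z ≢ x → redirect x p z ≡ z
redirect-other x p z ne rewrite ≡ᵇ-false ne = refl

consec-∈ : ∀ L a b → Consec L a b → a ∈ L × b ∈ L
consec-∈ (x ∷ y ∷ L) a b (inj₁ (refl , refl)) = here refl , there (here refl)
consec-∈ (x ∷ y ∷ L) a b (inj₂ c) with consec-∈ (y ∷ L) a b c
... | m1 , m2 = there m1 , there m2

closed-∈ : ∀ c ws z → z ∈ closed c ws → z ∈ c ∷ ws
closed-∈ c ws z m with ∈++ (c ∷ ws) (c ∷ []) m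
... | inj₁ m1 = m1
... | inj₂ (here refl) = here refl

consec-adj : ∀ {G} L a b → Consec L a b → ChainAdj G L → adj G a b ≡ true
consec-adj (x ∷ y ∷ L) a b (inj₁ (refl , refl)) (e , _) = e
consec-adj (x ∷ y ∷ L) a b (inj₂ c) (_ , ch) = consec-adj (y ∷ L) a b c ch

cycle-mono : ∀ {G H c ws} → (∀ z → z ∈ V G → z ∈ V H) →
  (∀ s t → s ∈ c ∷ ws → t ∈ c ∷ ws → adj G s t ≡ true → adj H s t ≡ true) → Cycle G c ws → Cycle H c ws
cycle-mono {G} {H} {c} {ws} sub hA (h , u , l , ch) =
  (λ z m → sub z (h z m)) , u , l , chain-mono (closed c ws) (λ s t m1 m2 → hA s t (closed-∈ c ws s m1) (closed-∈ c ws t m2)) ch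

record LeafAt (G : Graph) (x p : ℕ) : Set where
  constructor mkLeafAt
  field
    lx : x ∈ V G
    lp : p ∈ V G
    lne : x ≢ p
    ladj : adj G x p ≡ true
    lonly : ∀ z → adj G x z ≡ true → z ≡ p
open LeafAt public

symmetric-deleteVertex : ∀ G x → Symm G → Symm (deleteVertex G x)
symmetric-deleteVertex G x sy s t = bool-ext (sw s t) (sw t s)
  where
  sw : ∀ s t → adj (deleteVertex G x) s t ≡ true → adj (deleteVertex G x) t s ≡ true
  sw s t e = let (a , b , c) = deleteVertex-adj⁻ G x s t e in deleteVertex-adj⁺ G x t s (trans (sy t s) a) c b

simpleConnected-deleteLeaf : ∀ G x p → SimpleConnected G → LeafAt G x p → SimpleConnected (deleteVertex G x)
simpleConnected-deleteLeaf G x p pn (mkLeafAt lx lp lne ladj lonly) = record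
  { uniqueV = uniq-deleteVertex G x uniqueV
  ; symmetric = symmetric-deleteVertex G x symmetric
  ; irrefl = λ u → deleteVertex-adj-false G x u u (irrefl u)
  ; inV = λ u v e → let (a , b , c) = deleteVertex-adj⁻ G x u v e in deleteVertex-V⁺ G x u (inV u v a) b
  ; connected = conn-map G G2 (redirect x p) connected hV hE (λ z m → proj₁ (deleteVertex-V⁻ G x z m))
                  (λ z m → redirect-other x p z (proj₂ (deleteVertex-V⁻ G x z m)))
  }
  where
  open SimpleConnected pn
  G2 = deleteVertex G x
  px : p ≢ x
  px e = lne (sym e)
  pV : p ∈ V G2
  pV = deleteVertex-V⁺ G x p lp px
  hV : ∀ z → z ∈ V G → redirect x p z ∈ V G2
  hV z m with ≡ᵇ-view z x
  ... | isEq _ refl rewrite redirect-self x p = pV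
  ... | isNe _ ne rewrite redirect-other x p z ne = deleteVertex-V⁺ G x z m ne
  hE : ∀ s t → s ∈ V G → adj G s t ≡ true → Walk G2 (redirect x p s) (redirect x p t)
  hE s t m e with ≡ᵇ-view s x | ≡ᵇ-view t x
  ... | isEq _ refl | _ rewrite redirect-self x p | lonly t e | redirect-other x p p px = here pV
  ... | isNe _ ne | isEq _ refl rewrite redirect-self x p | lonly s (trans (symmetric x s) e) | redirect-other x p p px = here pV
  ... | isNe _ n1 | isNe _ n2 rewrite redirect-other x p s n1 | redirect-other x p t n2 =
    edge-walk (deleteVertex-V⁺ G x s m n1) (deleteVertex-V⁺ G x t (inV-target inV symmetric s t e) n2) (deleteVertex-adj⁺ G x s t e n1 n2)

twoCuttable-deleteLeaf : ∀ G x p → SimpleConnected G → LeafAt G x p →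
  (∀ c ws → SimpleCycle (deleteVertex G x) c ws → p ∈ c ∷ ws → ⊥) → TwoCuttable G → TwoCuttable (deleteVertex G x)
twoCuttable-deleteLeaf G x p pn (mkLeafAt lx lp lne ladj lonly) nocyc tc c ws cyc with tc c ws (cycle-mono (λ z m → proj₁ (deleteVertex-V⁻ G x z m)) (λ s t _ _ e → proj₁ (deleteVertex-adj⁻ G x s t e)) cyc)
... | a , b , cs , ia , ib = a , b , cs , tr a (closed-∈ c ws a (proj₁ (consec-∈ _ a b cs))) ia ,
                                         tr b (closed-∈ c ws b (proj₂ (consec-∈ _ a b cs))) ib
  where
  open SimpleConnected pn
  G2 = deleteVertex G x
  tr : ∀ z → z ∈ c ∷ ws → IncidentToCutEdge G z → IncidentToCutEdge G2 z
  tr z mz (z2 , (e , nc)) with proj₁ cyc z mz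
  ... | mzV with deleteVertex-V⁻ G x z mzV
  ... | zV , zx with ≡ᵇ-view z2 x
  ... | isEq _ refl = ⊥-elim (nocyc c ws (Cycle⇒SimpleCycle cyc) (subst (_∈ c ∷ ws) (lonly z (trans (symmetric x z) e)) mz))
  ... | isNe _ z2x = z2 , deleteVertex-adj⁺ G x z z2 e zx z2x , λ con → nc (connected-extend (deleteEdge G2 z z2) (deleteEdge G z z2) con
          (λ y m → proj₁ (deleteVertex-V⁻ G x y m)) hE cover (symmetric-deleteEdge G z z2 symmetric))
    where
    hE : ∀ s t → s ∈ V (deleteEdge G2 z z2) → adj (deleteEdge G2 z z2) s t ≡ true → Walk (deleteEdge G z z2) s t
    hE s t m e2 with deleteEdge-adj⁻ G2 z z2 s t e2
    ... | a1 , n1 , n2 with deleteVertex-adj⁻ G x s t a1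
    ... | a2 , _ , _ = edge-walk (proj₁ (deleteVertex-V⁻ G x s m)) (inV-target inV symmetric s t a2) (deleteEdge-adj⁺ G z z2 s t a2 n1 n2)
    cover : ∀ y → y ∈ V G → y ∈ V G2 ⊎ Σ ℕ λ w → w ∈ V G2 × Walk (deleteEdge G z z2) y w
    cover y m with ≡ᵇ-view y x
    ... | isNe _ ne = inj₁ (deleteVertex-V⁺ G x y m ne)
    ... | isEq _ refl = inj₂ (p , deleteVertex-V⁺ G x p lp (λ e → lne (sym e)) ,
            edge-walk lx lp (deleteEdge-adj⁺ G z z2 x p ladj (λ (q , _) → zx (sym q)) (λ (q , _) → z2x (sym q))))

simpleConnected-deleteEdge : ∀ G u v → SimpleConnected G → Walk (deleteEdge G u v) u v → SimpleConnected (deleteEdge G u v)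
simpleConnected-deleteEdge G u v pn w = record
  { uniqueV = uniqueV
  ; symmetric = symmetric-deleteEdge G u v symmetric
  ; irrefl = λ z → deleteEdge-adj-false G u v z z (irrefl z)
  ; inV = λ s t e → inV s t (proj₁ (deleteEdge-adj⁻ G u v s t e))
  ; connected = bypass-connected G u v connected symmetric inV w
  }
  where
  open SimpleConnected pn

connected-deleteEdge-swap : ∀ G u v → Connected (deleteEdge G u v) → Connected (deleteEdge G v u)
connected-deleteEdge-swap G u v con a b ma mb = walk-de-swap (con a b ma mb)

cut-edge-swap : ∀ G u v → SimpleConnected G → CutEdge G u v → CutEdge G v u
cut-edge-swap G u v pn (e , nc) = trans (SimpleConnected.symmetric pn v u) e , λ con → nc (connected-deleteEdge-swap G v u con)

twoCuttable-deleteEdge : ∀ G u v → SimpleConnected G → Connected (deleteEdge G u v) → TwoCuttable G → TwoCuttable (deleteEdge G u v)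
twoCuttable-deleteEdge G u v pn cde tc c ws cyc with tc c ws (cycle-mono (λ z m → m) (λ s t _ _ e → proj₁ (deleteEdge-adj⁻ G u v s t e)) cyc)
... | a , b , cs , ia , ib = a , b , cs , tr a ia , tr b ib
  where
  open SimpleConnected pn
  G2 = deleteEdge G u v
  tr : ∀ z → IncidentToCutEdge G z → IncidentToCutEdge G2 z
  tr z (z2 , (e , nc)) with ≟-pair z z2 u v | ≟-pair z z2 v u
  ... | yes (refl , refl) | _ = ⊥-elim (nc cde)
  ... | no _ | yes (refl , refl) = ⊥-elim (nc (connected-deleteEdge-swap G u v cde))
  ... | no n1 | no n2 = z2 , deleteEdge-adj⁺ G u v z z2 e n1 n2 ,
        λ con → nc (conn-map (deleteEdge G2 z z2) (deleteEdge G z z2) (λ y → y) con (λ y m → m) hE (λ y m → m) (λ y m → refl))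
    where
    hE : ∀ s t → s ∈ V G → adj (deleteEdge G2 z z2) s t ≡ true → Walk (deleteEdge G z z2) s t
    hE s t m e2 with deleteEdge-adj⁻ G2 z z2 s t e2
    ... | a1 , m1 , m2 with deleteEdge-adj⁻ G u v s t a1
    ... | a2 , _ , _ = edge-walk m (inV-target inV symmetric s t a2) (deleteEdge-adj⁺ G z z2 s t a2 m1 m2)

record PendantDeg2 (H : Graph) (w : ℕ) : Set where
  constructor mkPendantDeg2
  field
    sa sb : ℕ
    seq : neighbours H w ≡ sa ∷ sb ∷ []
    sl so : ℕ
    slo : (sl ≡ sa × so ≡ sb) ⊎ (sl ≡ sb × so ≡ sa)
    slV : sl ∈ V H
    soV : so ∈ V H
    wl : adj H w sl ≡ true
    wo : adj H w so ≡ true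
    lne : sl ≢ so
    lw : sl ≢ w
    ow : so ≢ w
    wonly : ∀ z → adj H w z ≡ true → z ≡ sl ⊎ z ≡ so
    lonly : ∀ z → adj H sl z ≡ true → z ≡ w
open PendantDeg2 public

module Suppress (H : Graph) (w : ℕ) (pn : SimpleConnected H) (d : PendantDeg2 H w) where
  open SimpleConnected pn
  a = sa d
  b = sb d
  ℓ = sl d
  o = so d
  H1 = deleteVertex H w
  G2 = addEdge H1 a b

  G2adj⁻ : ∀ s t → adj G2 s t ≡ true → (adj H s t ≡ true × s ≢ w × t ≢ w) ⊎ (s ≡ ℓ × t ≡ o) ⊎ (s ≡ o × t ≡ ℓ)
  G2adj⁻ s t e with addEdge-adj⁻ H1 a b s t e | slo d
  ... | inj₁ x | _ = inj₁ (deleteVertex-adj⁻ H w s t x)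
  ... | inj₂ (inj₁ (p , q)) | inj₁ (p2 , q2) = inj₂ (inj₁ (trans p (sym p2) , trans q (sym q2)))
  ... | inj₂ (inj₁ (p , q)) | inj₂ (p2 , q2) = inj₂ (inj₂ (trans p (sym q2) , trans q (sym p2)))
  ... | inj₂ (inj₂ (p , q)) | inj₁ (p2 , q2) = inj₂ (inj₂ (trans p (sym q2) , trans q (sym p2)))
  ... | inj₂ (inj₂ (p , q)) | inj₂ (p2 , q2) = inj₂ (inj₁ (trans p (sym p2) , trans q (sym q2)))

  G2old : ∀ s t → adj H s t ≡ true → s ≢ w → t ≢ w → adj G2 s t ≡ true
  G2old s t e n1 n2 = addEdge-adj⁺ H1 a b s t (deleteVertex-adj⁺ H w s t e n1 n2)

  G2lo : adj G2 ℓ o ≡ true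
  G2lo with slo d
  ... | inj₁ (refl , refl) = addEdge-ab H1 a b
  ... | inj₂ (refl , refl) = addEdge-ba H1 a b

  G2ol : adj G2 o ℓ ≡ true
  G2ol with slo d
  ... | inj₁ (refl , refl) = addEdge-ba H1 a b
  ... | inj₂ (refl , refl) = addEdge-ab H1 a b

  G2V⁻ : ∀ z → z ∈ V G2 → z ∈ V H × z ≢ w
  G2V⁻ z m = deleteVertex-V⁻ H w z m

  G2V⁺ : ∀ z → z ∈ V H → z ≢ w → z ∈ V G2
  G2V⁺ z m ne = deleteVertex-V⁺ H w z m ne

  ℓV : ℓ ∈ V G2
  ℓV = G2V⁺ ℓ (slV d) (lw d)
  oV : o ∈ V G2
  oV = G2V⁺ o (soV d) (ow d)

  ℓonly2 : ∀ t → adj G2 ℓ t ≡ true → t ≡ o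
  ℓonly2 t e with G2adj⁻ ℓ t e
  ... | inj₁ (a1 , _ , tw) = ⊥-elim (tw (lonly d t a1))
  ... | inj₂ (inj₁ (_ , q)) = q
  ... | inj₂ (inj₂ (p , _)) = ⊥-elim (lne d p)

  symm2 : Symm G2
  symm2 s t = bool-ext (sw s t) (sw t s)
    where
    sw : ∀ s t → adj G2 s t ≡ true → adj G2 t s ≡ true
    sw s t e with G2adj⁻ s t e
    ... | inj₁ (a1 , n1 , n2) = G2old t s (trans (symmetric t s) a1) n2 n1
    ... | inj₂ (inj₁ (refl , refl)) = G2ol
    ... | inj₂ (inj₂ (refl , refl)) = G2lo

  irr2 : ∀ z → adj G2 z z ≡ false
  irr2 z with adj G2 z z in e
  ... | false = refl
  ... | true with G2adj⁻ z z e
  ... | inj₁ (a1 , _) = ⊥-elim (true≢false (trans (sym a1) (irrefl z)))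
  ... | inj₂ (inj₁ (p , q)) = ⊥-elim (lne d (trans (sym p) q))
  ... | inj₂ (inj₂ (p , q)) = ⊥-elim (lne d (trans (sym q) p))

  inV2' : ∀ s t → adj G2 s t ≡ true → s ∈ V G2
  inV2' s t e with G2adj⁻ s t e
  ... | inj₁ (a1 , n1 , _) = G2V⁺ s (inV s t a1) n1
  ... | inj₂ (inj₁ (refl , _)) = ℓV
  ... | inj₂ (inj₂ (refl , _)) = oV

  wV : w ∈ V H
  wV = inV w ℓ (wl d)

  conn2 : Connected G2
  conn2 = conn-map H G2 (redirect w ℓ) connected hV hE (λ z m → proj₁ (G2V⁻ z m)) (λ z m → redirect-other w ℓ z (proj₂ (G2V⁻ z m)))
    where
    hV : ∀ z → z ∈ V H → redirect w ℓ z ∈ V G2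
    hV z m with ≡ᵇ-view z w
    ... | isEq _ refl rewrite redirect-self w ℓ = ℓV
    ... | isNe _ ne rewrite redirect-other w ℓ z ne = G2V⁺ z m ne
    hE : ∀ s t → s ∈ V H → adj H s t ≡ true → Walk G2 (redirect w ℓ s) (redirect w ℓ t)
    hE s t m e with ≡ᵇ-view s w | ≡ᵇ-view t w
    ... | isEq _ refl | isEq _ refl = ⊥-elim (true≢false (trans (sym e) (irrefl w)))
    ... | isEq _ refl | isNe _ tw rewrite redirect-self w ℓ | redirect-other w ℓ t tw with wonly d t e
    ... | inj₁ refl = here ℓV
    ... | inj₂ refl = edge-walk ℓV oV G2lo
    hE s t m e | isNe _ sw | isEq _ refl rewrite redirect-self w ℓ | redirect-other w ℓ s sw with wonly d s (trans (symmetric w s) e)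
    ... | inj₁ refl = here ℓV
    ... | inj₂ refl = edge-walk oV ℓV G2ol
    hE s t m e | isNe _ sw | isNe _ tw rewrite redirect-other w ℓ s sw | redirect-other w ℓ t tw =
      edge-walk (G2V⁺ s m sw) (G2V⁺ t (inV-target inV symmetric s t e) tw) (G2old s t e sw tw)

  simpleConnected : SimpleConnected G2
  simpleConnected = record
    { uniqueV = uniq-deleteVertex H w uniqueV
    ; symmetric = symm2
    ; irrefl = irr2
    ; inV = inV2'
    ; connected = conn2
    }

  ℓ-off-cycle : ∀ {c ws} → Cycle G2 c ws → ℓ ∉ c ∷ ws
  ℓ-off-cycle cyc m = unique-neighbour-off-cycle symm2 (Cycle⇒SimpleCycle cyc) m ℓonly2

  cycle-in-H : ∀ {c ws} → Cycle G2 c ws → Cycle H c ws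
  cycle-in-H {c} {ws} cyc = cycle-mono (λ z m → proj₁ (G2V⁻ z m)) old-edge cyc
    where
    old-edge : ∀ s t → s ∈ c ∷ ws → t ∈ c ∷ ws → adj G2 s t ≡ true → adj H s t ≡ true
    old-edge s t m1 m2 e with G2adj⁻ s t e
    ... | inj₁ (a1 , _) = a1
    ... | inj₂ (inj₁ (refl , _)) = ⊥-elim (ℓ-off-cycle cyc m1)
    ... | inj₂ (inj₂ (_ , refl)) = ⊥-elim (ℓ-off-cycle cyc m2)

  cut-edge-away-from-w : ∀ z z2 → z ≢ w → z2 ≢ w → CutEdge H z z2 → CutEdge G2 z z2
  cut-edge-away-from-w z z2 zw z2w (e , nc) = G2old z z2 e zw z2w ,
    λ con → nc (connected-extend (deleteEdge G2 z z2) (deleteEdge H z z2) con (λ y m → proj₁ (G2V⁻ y m)) hE cover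
                  (symmetric-deleteEdge H z z2 symmetric))
    where
    into-w : ∀ s → adj H s w ≡ true → adj (deleteEdge H z z2) s w ≡ true
    into-w s e2 = deleteEdge-adj⁺ H z z2 s w e2 (λ (_ , q) → z2w (sym q)) (λ (_ , q) → zw (sym q))
    from-w : ∀ s → adj H w s ≡ true → adj (deleteEdge H z z2) w s ≡ true
    from-w s e2 = deleteEdge-adj⁺ H z z2 w s e2 (λ (p , _) → zw (sym p)) (λ (p , _) → z2w (sym p))
    hE : ∀ s t → s ∈ V (deleteEdge G2 z z2) → adj (deleteEdge G2 z z2) s t ≡ true → Walk (deleteEdge H z z2) s t
    hE s t m e2 with deleteEdge-adj⁻ G2 z z2 s t e2
    ... | a2 , m1 , m2 with G2adj⁻ s t a2
    ... | inj₁ (a3 , _ , _) = edge-walk (proj₁ (G2V⁻ s m)) (inV-target inV symmetric s t a3) (deleteEdge-adj⁺ H z z2 s t a3 m1 m2)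
    ... | inj₂ (inj₁ (refl , refl)) = step (slV d) (into-w ℓ (trans (symmetric ℓ w) (wl d))) (edge-walk wV (soV d) (from-w o (wo d)))
    ... | inj₂ (inj₂ (refl , refl)) = step (soV d) (into-w o (trans (symmetric o w) (wo d))) (edge-walk wV (slV d) (from-w ℓ (wl d)))
    cover : ∀ y → y ∈ V H → y ∈ V G2 ⊎ Σ ℕ λ t → t ∈ V G2 × Walk (deleteEdge H z z2) y t
    cover y m with ≡ᵇ-view y w
    ... | isNe _ ne = inj₁ (G2V⁺ y m ne)
    ... | isEq _ refl = inj₂ (ℓ , ℓV , edge-walk wV (slV d) (from-w ℓ (wl d)))

  incident-on-cycle : ∀ {c ws} → Cycle G2 c ws → ∀ z → z ∈ c ∷ ws → IncidentToCutEdge H z → IncidentToCutEdge G2 z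
  incident-on-cycle cyc z mz (z2 , cut) with G2V⁻ z (proj₁ cyc z mz) | ≡ᵇ-view z2 w
  ... | _ , zw | isNe _ z2w = z2 , cut-edge-away-from-w z z2 zw z2w cut
  ... | _ | isEq _ refl with wonly d z (trans (symmetric w z) (proj₁ cut))
  ...   | inj₁ refl = ⊥-elim (ℓ-off-cycle cyc mz)
  ...   | inj₂ refl = ℓ , pendant-edge-cut G2 o ℓ G2ol ℓonly2 (lne d) ℓV oV

  twoCuttable : TwoCuttable H → TwoCuttable G2
  twoCuttable tc c ws cyc with tc c ws (cycle-in-H cyc)
  ... | a1 , b1 , cs , ia , ib = a1 , b1 , cs ,
    incident-on-cycle cyc a1 (closed-∈ c ws a1 (proj₁ (consec-∈ _ a1 b1 cs))) ia ,
    incident-on-cycle cyc b1 (closed-∈ c ws b1 (proj₂ (consec-∈ _ a1 b1 cs))) ib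

-- Reducing cherries and reticulated cherries

record TwoCuttableNetwork (G : Graph) : Set where
  constructor mkTCN
  field
    net : IsNetwork G
    tcut : TwoCuttable G
open TwoCuttableNetwork public

network⇒simpleConnected : ∀ {G} → IsNetwork G → SimpleConnected G
network⇒simpleConnected n = record
  { uniqueV = IsNetwork.uniqueV n
  ; symmetric = IsNetwork.symmetric n
  ; irrefl = IsNetwork.irrefl n
  ; inV = IsNetwork.inV n
  ; connected = IsNetwork.connected n
  }

¬true⇒false : ∀ {b} → (b ≡ true → ⊥) → b ≡ false
¬true⇒false {false} _ = refl
¬true⇒false {true} f = ⊥-elim (f refl)

adj⇒≢ : ∀ {G} → SimpleConnected G → ∀ s t → adj G s t ≡ true → s ≢ t
adj⇒≢ pn s t e refl = true≢false (trans (sym e) (SimpleConnected.irrefl pn s))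

adj⇒Nbr : ∀ {G} → SimpleConnected G → ∀ s t → adj G s t ≡ true → Nbr G s t
adj⇒Nbr pn s t e = mkNbr (inV-target (SimpleConnected.inV pn) (SimpleConnected.symmetric pn) s t e) e

leaf⇒LeafAt : ∀ {G x p} → IsNetwork G → Leaf G x → adj G x p ≡ true → LeafAt G x p
leaf⇒LeafAt {G} {x} {p} n (mx , d1) e with deg1-view G x d1
... | mkDeg1 p0 pN only = mkLeafAt mx (inV-target inV symmetric x p e) (adj⇒≢ (network⇒simpleConnected n) x p e) e lon
  where
  open IsNetwork n
  pp : p ≡ p0
  pp = only p (adj⇒Nbr (network⇒simpleConnected n) x p e)
  lon : ∀ z → adj G x z ≡ true → z ≡ p
  lon z e2 = trans (only z (adj⇒Nbr (network⇒simpleConnected n) x z e2)) (sym pp)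

leaf-neighbours : ∀ {G x p} → IsNetwork G → Leaf G x → adj G x p ≡ true → neighbours G x ≡ p ∷ []
leaf-neighbours {G} {x} {p} n (mx , d1) e with length≡1 (neighbours G x) d1
... | a , eq = trans eq (cong (_∷ []) (LeafAt.lonly (leaf⇒LeafAt n (mx , d1) e) a (proj₂ (∈-neighbours⁻ G x a (subst (a ∈_) (sym eq) (here refl))))))

record Third (G : Graph) (v x y : ℕ) : Set where
  constructor mkThird
  field
    q : ℕ
    qN : Nbr G v q
    qx : q ≢ x
    qy : q ≢ y
    only3 : ∀ z → Nbr G v z → z ≡ x ⊎ z ≡ y ⊎ z ≡ q

swap₁₂ : ∀ {A B C : Set} → A ⊎ B ⊎ C → B ⊎ A ⊎ C
swap₁₂ (inj₁ a) = inj₂ (inj₁ a)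
swap₁₂ (inj₂ (inj₁ b)) = inj₁ b
swap₁₂ (inj₂ (inj₂ c)) = inj₂ (inj₂ c)

other-than : ∀ {A : Set} {z x : ℕ} → z ≢ x → z ≡ x ⊎ A → A
other-than z≢x (inj₁ z≡x) = ⊥-elim (z≢x z≡x)
other-than _ (inj₂ a) = a

swap₂₃ : ∀ {A B C : Set} → A ⊎ B ⊎ C → A ⊎ C ⊎ B
swap₂₃ = map₂ swap

record Others (G : Graph) (v p : ℕ) : Set where
  constructor mkOthers
  field
    o1 o2 : ℕ
    o1N : Nbr G v o1
    o2N : Nbr G v o2
    o12 : o1 ≢ o2
    o1p : o1 ≢ p
    o2p : o2 ≢ p
    oonly : ∀ z → Nbr G v z → z ≡ p ⊎ z ≡ o1 ⊎ z ≡ o2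

-- Opaque, so that the case analyses below do not unfold these neighbour choices, which is
-- prohibitively expensive for the type checker.

opaque
  others : ∀ {G v p} → Deg3 G v → Nbr G v p → Others G v p
  others (mkDeg3 a b c aN bN cN ab ac bc only) pN with only _ pN
  ... | inj₁ refl = mkOthers b c bN cN bc (λ e → ab (sym e)) (λ e → ac (sym e)) only
  ... | inj₂ (inj₁ refl) = mkOthers a c aN cN ac ab (λ e → bc (sym e)) (λ z n → swap₁₂ (only z n))
  ... | inj₂ (inj₂ refl) = mkOthers a b aN bN ab ac bc (λ z n → swap₁₂ (swap₂₃ (only z n)))

  third : ∀ {G v x y} → Deg3 G v → Nbr G v x → Nbr G v y → x ≢ y → Third G v x y
  third D xN yN x≢y with others D xN
  ... | mkOthers o1 o2 o1N o2N o12 o1x o2x only with only _ yN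
  ...   | inj₁ y≡x = ⊥-elim (x≢y (sym y≡x))
  ...   | inj₂ (inj₁ refl) = mkThird o2 o2N o2x (λ e → o12 (sym e)) only
  ...   | inj₂ (inj₂ refl) = mkThird o1 o1N o1x o12 (λ z n → swap₂₃ (only z n))

deg3⇒Internal : ∀ G {v} → v ∈ V G → deg G v ≡ 3 → Internal G v
deg3⇒Internal G vV d3 = vV , λ d1 → case trans (sym d1) d3 of λ ()

non-leaf⇒deg3 : ∀ {G v} → IsNetwork G → v ∈ V G → (deg G v ≡ 1 → ⊥) → deg G v ≡ 3
non-leaf⇒deg3 n m ne with IsNetwork.degrees n _ m
... | inj₁ e = ⊥-elim (ne e)
... | inj₂ e = e

two-neighbours⇒non-leaf : ∀ {G v a b} → Nbr G v a → Nbr G v b → a ≢ b → deg G v ≡ 1 → ⊥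
two-neighbours⇒non-leaf {G} {v} aN bN ne d1 with deg1-view G v d1
... | mkDeg1 p pN only = ne (trans (only _ aN) (sym (only _ bN)))

length-remove-≤ : ∀ x L → length (remove x L) ≤ length L
length-remove-≤ x [] = z≤n
length-remove-≤ x (z ∷ L) with not (z ≡ᵇ x)
... | true = s≤s (length-remove-≤ x L)
... | false = ≤-trans (length-remove-≤ x L) (n≤1+n _)

pair-order : ∀ {y q a b : ℕ} → (y ≡ a ⊎ y ≡ b) → (q ≡ a ⊎ q ≡ b) → y ≢ q → (y ≡ a × q ≡ b) ⊎ (y ≡ b × q ≡ a)
pair-order (inj₁ p) (inj₁ r) ne = ⊥-elim (ne (trans p (sym r)))
pair-order (inj₁ p) (inj₂ r) ne = inj₁ (p , r)
pair-order (inj₂ p) (inj₁ r) ne = inj₂ (p , r)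
pair-order (inj₂ p) (inj₂ r) ne = ⊥-elim (ne (trans p (sym r)))

pendant-neighbours-nonadjacent : ∀ H w a b ℓ → SimpleConnected H → adj H w a ≡ true → adj H w b ≡ true → (∀ z → adj H ℓ z ≡ true → z ≡ w) →
  (ℓ ≡ a ⊎ ℓ ≡ b) → adj H a b ≡ false
pendant-neighbours-nonadjacent H w a b ℓ pn ea eb lo (inj₁ refl) = ¬true⇒false (λ e → adj⇒≢ pn w b eb (sym (lo b e)))
pendant-neighbours-nonadjacent H w a b ℓ pn ea eb lo (inj₂ refl) = ¬true⇒false (λ e → adj⇒≢ pn w a ea (sym (lo a (trans (SimpleConnected.symmetric pn b a) e))))

or-of : ∀ {A B C D : Set} → (A × B) ⊎ (C × D) → A ⊎ C
or-of (inj₁ (a , _)) = inj₁ a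
or-of (inj₂ (c , _)) = inj₂ c

record CherryAt (G : Graph) (x y p : ℕ) : Set where
  constructor mkCherryAt
  field
    cxy : x ≢ y
    lfx : Leaf G x
    lfy : Leaf G y
    axp : adj G x p ≡ true
    ayp : adj G y p ≡ true
    three : (3 ≤ᵇ length (leaves G)) ≡ true
open CherryAt public

reduceCherry-unfold : ∀ G x p → neighbours G x ≡ p ∷ [] → (3 ≤ᵇ length (leaves G)) ≡ true →
  reduceCherry G x ≡ suppress (deleteVertex G x) p
reduceCherry-unfold G x p e1 e2 rewrite e1 | e2 = refl

ReducesTo : Graph → Graph → Set
ReducesTo G H = TwoCuttableNetwork H × length (V H) < length (V G)

CherryAt⇒IsCherry : ∀ {G x y p} → CherryAt G x y p → IsCherry G x y
CherryAt⇒IsCherry cd = cxy cd , lfx cd , lfy cd , inj₂ (_ , axp cd , ayp cd)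

module CherryReduction (G : Graph) (x y p : ℕ) (iv : TwoCuttableNetwork G) (cd : CherryAt G x y p) where
  open IsNetwork (net iv)
  pn = network⇒simpleConnected (net iv)
  LA = leaf⇒LeafAt (net iv) (lfx cd) (axp cd)
  LY = leaf⇒LeafAt (net iv) (lfy cd) (ayp cd)
  px : p ≢ x
  px e = adj⇒≢ pn x p (axp cd) (sym e)
  py : p ≢ y
  py e = adj⇒≢ pn y p (ayp cd) (sym e)
  yx : y ≢ x
  yx e = cxy cd (sym e)
  apx : adj G p x ≡ true
  apx = trans (symmetric p x) (axp cd)
  apy : adj G p y ≡ true
  apy = trans (symmetric p y) (ayp cd)
  pV : p ∈ V G
  pV = inV p x apx
  xN = adj⇒Nbr pn p x apx
  yN = adj⇒Nbr pn p y apy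
  d3 : deg G p ≡ 3
  d3 = non-leaf⇒deg3 (net iv) pV (two-neighbours⇒non-leaf xN yN (cxy cd))
  D3 = deg3-view G p uniqueV d3
  Tc = third D3 xN yN (cxy cd)
  q = Third.q Tc
  qx = Third.qx Tc
  qy = Third.qy Tc
  G1 = deleteVertex G x
  pn1 = simpleConnected-deleteLeaf G x p pn LA
  d2 : deg G1 p ≡ 2
  d2 = suc-injective (trans (sym (deg-deleteVertex-adjacent G x p uniqueV (lx LA) px apx)) d3)
  D2 = deg2-view G1 p (SimpleConnected.uniqueV pn1) d2
  yN1 : Nbr G1 p y
  yN1 = mkNbr (deleteVertex-V⁺ G x y (proj₁ (lfy cd)) yx) (deleteVertex-adj⁺ G x p y apy px yx)
  qN1 : Nbr G1 p q
  qN1 = mkNbr (deleteVertex-V⁺ G x q (nbrV (Third.qN Tc)) qx) (deleteVertex-adj⁺ G x p q (nbrAdj (Third.qN Tc)) px qx)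
  wonly1 : ∀ z → adj G1 p z ≡ true → z ≡ y ⊎ z ≡ q
  wonly1 z e = let (a1 , _ , z≢x) = deleteVertex-adj⁻ G x p z e in
    other-than z≢x (Third.only3 Tc z (adj⇒Nbr pn p z a1))
  lonly1 : ∀ z → adj G1 y z ≡ true → z ≡ p
  lonly1 z e = LeafAt.lonly LY z (proj₁ (deleteVertex-adj⁻ G x y z e))
  slo1 = pair-order (Deg2.only D2 y yN1) (Deg2.only D2 q qN1) (λ e → qy (sym e))
  SD : PendantDeg2 G1 p
  SD = mkPendantDeg2 (Deg2.a D2) (Deg2.b D2) (Deg2.eqn D2) y q slo1 (nbrV yN1) (nbrV qN1) (nbrAdj yN1) (nbrAdj qN1)
         (λ e → qy (sym e)) (λ e → py (sym e)) (λ e → adj⇒≢ pn1 p q (nbrAdj qN1) (sym e)) wonly1 lonly1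

  open Suppress G1 p pn1 SD
  eqG : suppress G1 p ≡ G2
  eqG = suppress-unfold G1 p (sa SD) (sb SD) (seq SD)
  fab : adj G1 (Deg2.a D2) (Deg2.b D2) ≡ false
  fab = pendant-neighbours-nonadjacent G1 p (Deg2.a D2) (Deg2.b D2) y pn1 (nbrAdj (Deg2.aN D2)) (nbrAdj (Deg2.bN D2)) lonly1 (or-of slo1)
  nocyc : ∀ c ws → SimpleCycle G1 c ws → p ∈ c ∷ ws → ⊥
  nocyc c ws cy m =
    let (z1 , z2 , ne , e1 , e2 , m1 , m2) = cycle-two-neighbours (SimpleConnected.symmetric pn1) cy m in
    y-or-q-off-cycle z1 z2 ne m1 m2 (wonly1 z1 e1) (wonly1 z2 e2)
    where
    y-or-q-off-cycle : ∀ z1 z2 → z1 ≢ z2 → z1 ∈ c ∷ ws → z2 ∈ c ∷ ws → (z1 ≡ y ⊎ z1 ≡ q) → (z2 ≡ y ⊎ z2 ≡ q) → ⊥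
    y-or-q-off-cycle z1 z2 ne m1 m2 (inj₁ refl) _ = unique-neighbour-off-cycle (SimpleConnected.symmetric pn1) cy m1 lonly1
    y-or-q-off-cycle z1 z2 ne m1 m2 (inj₂ _) (inj₁ refl) = unique-neighbour-off-cycle (SimpleConnected.symmetric pn1) cy m2 lonly1
    y-or-q-off-cycle z1 z2 ne m1 m2 (inj₂ refl) (inj₂ refl) = ne refl
  tcG2 : TwoCuttable G2
  tcG2 = twoCuttable (twoCuttable-deleteLeaf G x p pn LA nocyc (tcut iv))
  degG2 : ∀ z → z ∈ V G2 → deg G2 z ≡ deg G z
  degG2 z m = trans (subst (λ H → deg H z ≡ deg G1 z) eqG (deg-suppress G1 p pn1 D2 fab z zp))
                    (deg-deleteVertex-nonadjacent G x z zx (¬true⇒false (λ e → zp (LeafAt.lonly LA z (trans (symmetric x z) e)))))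
    where
    zp : z ≢ p
    zp = proj₂ (G2V⁻ z m)
    zx : z ≢ x
    zx = proj₂ (deleteVertex-V⁻ G x z (proj₁ (G2V⁻ z m)))
  yV2 : y ∈ V G2
  yV2 = G2V⁺ y (nbrV yN1) (λ e → py (sym e))
  netG2 : IsNetwork G2
  netG2 = record
    { uniqueV = SimpleConnected.uniqueV simpleConnected
    ; symmetric = SimpleConnected.symmetric simpleConnected
    ; irrefl = SimpleConnected.irrefl simpleConnected
    ; inV = SimpleConnected.inV simpleConnected
    ; connected = SimpleConnected.connected simpleConnected
    ; degrees = λ v m → subst (λ k → k ≡ 1 ⊎ k ≡ 3) (sym (degG2 v m)) (degrees v (proj₁ (deleteVertex-V⁻ G x v (proj₁ (G2V⁻ v m)))))
    ; nonEmptyX = y , yV2 , trans (degG2 y yV2) (proj₂ (lfy cd))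
    }
  lenG2 : length (V G2) < length (V G)
  lenG2 = ≤-trans (s≤s (length-remove-≤ p (remove x (V G)))) (length-remove-< (V G) (lx LA))
  eqR : reduceCherry G x ≡ G2
  eqR = trans (reduceCherry-unfold G x p (leaf-neighbours (net iv) (lfx cd) (axp cd)) (three cd)) eqG
  result : ReducesTo G (reduceCherry G x)
  result = subst (ReducesTo G) (sym eqR) (mkTCN netG2 tcG2 , lenG2)

module RetCherryReduction (G : Graph) (x y u v : ℕ) (iv : TwoCuttableNetwork G) (xy : x ≢ y) (lfx : Leaf G x) (lfy : Leaf G y)
  (uv : u ≢ v) (inu : Internal G u) (inw : Internal G v) (axu : adj G x u ≡ true) (auv : adj G u v ≡ true)
  (avy : adj G v y ≡ true) (oc : OnCycle G u v) where
  open IsNetwork (net iv)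
  pn = network⇒simpleConnected (net iv)
  ayv : adj G y v ≡ true
  ayv = trans (symmetric y v) avy
  aux : adj G u x ≡ true
  aux = trans (symmetric u x) axu
  avu : adj G v u ≡ true
  avu = trans (symmetric v u) auv
  LX = leaf⇒LeafAt (net iv) lfx axu
  LY = leaf⇒LeafAt (net iv) lfy ayv
  uV : u ∈ V G
  uV = proj₁ inu
  vV : v ∈ V G
  vV = proj₁ inw
  uy : u ≢ y
  uy refl = proj₂ inu (proj₂ lfy)
  vx : v ≢ x
  vx refl = proj₂ inw (proj₂ lfx)
  xv : x ≢ v
  xv e = vx (sym e)
  yu : y ≢ u
  yu e = uy (sym e)
  xu : x ≢ u
  xu = adj⇒≢ pn x u axu
  yv : y ≢ v
  yv = adj⇒≢ pn y v ayv
  vu : v ≢ u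
  vu e = uv (sym e)
  D3u = deg3-view G u uniqueV (non-leaf⇒deg3 (net iv) uV (proj₂ inu))
  D3v = deg3-view G v uniqueV (non-leaf⇒deg3 (net iv) vV (proj₂ inw))
  Tu = third D3u (adj⇒Nbr pn u x aux) (adj⇒Nbr pn u v auv) xv
  Tv = third D3v (adj⇒Nbr pn v u avu) (adj⇒Nbr pn v y avy) uy
  a = Third.q Tu
  b = Third.q Tv
  ax : a ≢ x
  ax = Third.qx Tu
  av : a ≢ v
  av = Third.qy Tu
  bu : b ≢ u
  bu = Third.qx Tv
  by : b ≢ y
  by = Third.qy Tv
  ua : adj G u a ≡ true
  ua = nbrAdj (Third.qN Tu)
  vb : adj G v b ≡ true
  vb = nbrAdj (Third.qN Tv)
  ay : a ≢ y
  ay e = uv (LeafAt.lonly LY u (subst (λ k → adj G k u ≡ true) e (trans (symmetric a u) ua)))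
  au : a ≢ u
  au e = adj⇒≢ pn u a ua (sym e)
  bv : b ≢ v
  bv e = adj⇒≢ pn v b vb (sym e)
  cyc-data : Σ ℕ λ c → Σ (List ℕ) λ ws → SimpleCycle G c ws × u ∈ c ∷ ws × v ∈ c ∷ ws
  cyc-data = cd oc
    where
    cd : OnCycle G u v → Σ ℕ λ c → Σ (List ℕ) λ ws → SimpleCycle G c ws × u ∈ c ∷ ws × v ∈ c ∷ ws
    cd (c , ws , cy , inj₁ cs) = c , ws , Cycle⇒SimpleCycle cy , closed-∈ c ws u (proj₁ (consec-∈ _ u v cs)) ,
                                closed-∈ c ws v (proj₂ (consec-∈ _ u v cs))
    cd (c , ws , cy , inj₂ cs) = c , ws , Cycle⇒SimpleCycle cy , closed-∈ c ws u (proj₂ (consec-∈ _ v u cs)) ,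
                                closed-∈ c ws v (proj₁ (consec-∈ _ v u cs))
  bywalk : Walk (deleteEdge G u v) u v
  bywalk with cyc-data
  ... | c , ws , cy , mu , mv = cycle-bypass symmetric cy mu mv uv
  G1 = deleteEdge G u v
  pn1 = simpleConnected-deleteEdge G u v pn bywalk
  tc1 : TwoCuttable G1
  tc1 = twoCuttable-deleteEdge G u v pn (SimpleConnected.connected pn1) (tcut iv)
  d2u : deg G1 u ≡ 2
  d2u = suc-injective (trans (sym (deg-deleteEdge-endˡ G u v uniqueV uv vV auv)) (non-leaf⇒deg3 (net iv) uV (proj₂ inu)))
  d2v : deg G1 v ≡ 2
  d2v = suc-injective (trans (sym (deg-deleteEdge-endʳ G u v uniqueV uv uV avu)) (non-leaf⇒deg3 (net iv) vV (proj₂ inw)))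
  D2u = deg2-view G1 u uniqueV d2u
  g1u : ∀ t → adj G u t ≡ true → t ≢ v → adj G1 u t ≡ true
  g1u t e n = deleteEdge-adj⁺ G u v u t e (λ (_ , q) → n q) (λ (p , _) → uv p)
  xN1 : Nbr G1 u x
  xN1 = mkNbr (proj₁ lfx) (g1u x aux xv)
  aN1 : Nbr G1 u a
  aN1 = mkNbr (nbrV (Third.qN Tu)) (g1u a ua av)
  wonly1 : ∀ z → adj G1 u z ≡ true → z ≡ x ⊎ z ≡ a
  wonly1 z e = let (a1 , n1 , _) = deleteEdge-adj⁻ G u v u z e in
    other-than (λ z≡v → n1 (refl , z≡v)) (swap₁₂ (Third.only3 Tu z (adj⇒Nbr pn u z a1)))
  lonly1 : ∀ z → adj G1 x z ≡ true → z ≡ u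
  lonly1 z e = LeafAt.lonly LX z (proj₁ (deleteEdge-adj⁻ G u v x z e))
  slo1 = pair-order (Deg2.only D2u x xN1) (Deg2.only D2u a aN1) (λ e → ax (sym e))
  SD1 : PendantDeg2 G1 u
  SD1 = mkPendantDeg2 (Deg2.a D2u) (Deg2.b D2u) (Deg2.eqn D2u) x a slo1 (nbrV xN1) (nbrV aN1) (nbrAdj xN1) (nbrAdj aN1)
          (λ e → ax (sym e)) xu au wonly1 lonly1
  module S1 = Suppress G1 u pn1 SD1
  K = S1.G2
  eq1 : suppress G1 u ≡ K
  eq1 = suppress-unfold G1 u (sa SD1) (sb SD1) (seq SD1)
  fab1 : adj G1 (Deg2.a D2u) (Deg2.b D2u) ≡ false
  fab1 = pendant-neighbours-nonadjacent G1 u (Deg2.a D2u) (Deg2.b D2u) x pn1 (nbrAdj (Deg2.aN D2u)) (nbrAdj (Deg2.bN D2u)) lonly1 (or-of slo1)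
  degK : ∀ z → z ≢ u → deg K z ≡ deg G1 z
  degK z zu = subst (λ H → deg H z ≡ deg G1 z) eq1 (deg-suppress G1 u pn1 D2u fab1 z zu)
  pn2 = S1.simpleConnected
  d2v2 : deg K v ≡ 2
  d2v2 = trans (degK v vu) d2v
  D2v = deg2-view K v (SimpleConnected.uniqueV pn2) d2v2
  g1v : ∀ t → adj G v t ≡ true → t ≢ u → adj G1 v t ≡ true
  g1v t e n = deleteEdge-adj⁺ G u v v t e (λ (p , _) → vu p) (λ (_ , q) → n q)
  yN2 : Nbr K v y
  yN2 = mkNbr (S1.G2V⁺ y (proj₁ lfy) yu) (S1.G2old v y (g1v y avy yu) vu yu)
  bN2 : Nbr K v b
  bN2 = mkNbr (S1.G2V⁺ b (nbrV (Third.qN Tv)) bu) (S1.G2old v b (g1v b vb bu) vu bu)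
  wonly2 : ∀ z → adj K v z ≡ true → z ≡ y ⊎ z ≡ b
  wonly2 z e = by-edge (S1.G2adj⁻ v z e)
    where
    by-edge : (adj G1 v z ≡ true × v ≢ u × z ≢ u) ⊎ (v ≡ x × z ≡ a) ⊎ (v ≡ a × z ≡ x) → z ≡ y ⊎ z ≡ b
    by-edge (inj₂ (inj₁ (p , _))) = ⊥-elim (vx p)
    by-edge (inj₂ (inj₂ (p , _))) = ⊥-elim (av (sym p))
    by-edge (inj₁ (a1 , _ , zu)) = other-than zu (Third.only3 Tv z (adj⇒Nbr pn v z (proj₁ (deleteEdge-adj⁻ G u v v z a1))))
  lonly2 : ∀ z → adj K y z ≡ true → z ≡ v
  lonly2 z e = by-edge (S1.G2adj⁻ y z e)
    where
    by-edge : (adj G1 y z ≡ true × y ≢ u × z ≢ u) ⊎ (y ≡ x × z ≡ a) ⊎ (y ≡ a × z ≡ x) → z ≡ v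
    by-edge (inj₁ (a1 , _ , _)) = LeafAt.lonly LY z (proj₁ (deleteEdge-adj⁻ G u v y z a1))
    by-edge (inj₂ (inj₁ (p , _))) = ⊥-elim (xy (sym p))
    by-edge (inj₂ (inj₂ (p , _))) = ⊥-elim (ay (sym p))
  slo2 = pair-order (Deg2.only D2v y yN2) (Deg2.only D2v b bN2) (λ e → by (sym e))
  SD2 : PendantDeg2 K v
  SD2 = mkPendantDeg2 (Deg2.a D2v) (Deg2.b D2v) (Deg2.eqn D2v) y b slo2 (nbrV yN2) (nbrV bN2) (nbrAdj yN2) (nbrAdj bN2)
          (λ e → by (sym e)) yv bv wonly2 lonly2
  module S2 = Suppress K v pn2 SD2
  F = S2.G2
  eq2 : suppress K v ≡ F
  eq2 = suppress-unfold K v (sa SD2) (sb SD2) (seq SD2)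
  fab2 : adj K (Deg2.a D2v) (Deg2.b D2v) ≡ false
  fab2 = pendant-neighbours-nonadjacent K v (Deg2.a D2v) (Deg2.b D2v) y pn2 (nbrAdj (Deg2.aN D2v)) (nbrAdj (Deg2.bN D2v)) lonly2 (or-of slo2)
  degF : ∀ z → z ∈ V F → deg F z ≡ deg G z
  degF z m = trans (subst (λ H → deg H z ≡ deg K z) eq2 (deg-suppress K v pn2 D2v fab2 z zv))
                    (trans (degK z zu) (deg-deleteEdge-other G u v z zu zv))
    where
    zv : z ≢ v
    zv = proj₂ (S2.G2V⁻ z m)
    zu : z ≢ u
    zu = proj₂ (S1.G2V⁻ z (proj₁ (S2.G2V⁻ z m)))
  tcF : TwoCuttable F
  tcF = S2.twoCuttable (S1.twoCuttable tc1)
  xVF : x ∈ V F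
  xVF = S2.G2V⁺ x (S1.G2V⁺ x (proj₁ lfx) xu) xv
  netF : IsNetwork F
  netF = record
    { uniqueV = SimpleConnected.uniqueV S2.simpleConnected
    ; symmetric = SimpleConnected.symmetric S2.simpleConnected
    ; irrefl = SimpleConnected.irrefl S2.simpleConnected
    ; inV = SimpleConnected.inV S2.simpleConnected
    ; connected = SimpleConnected.connected S2.simpleConnected
    ; degrees = λ z m → subst (λ k → k ≡ 1 ⊎ k ≡ 3) (sym (degF z m))
                   (degrees z (proj₁ (S1.G2V⁻ z (proj₁ (S2.G2V⁻ z m)))))
    ; nonEmptyX = x , xVF , trans (degF x xVF) (proj₂ lfx)
    }
  lenF : length (V F) < length (V G)
  lenF = ≤-trans (s≤s (length-remove-≤ v (remove u (V G)))) (length-remove-< (V G) uV)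
  eqR : reduceRetCherry G u v ≡ F
  eqR = trans (cong (λ H → suppress H v) eq1) eq2
  result : ReducesTo G (reduceRetCherry G u v)
  result = subst (ReducesTo G) (sym eqR) (mkTCN netF tcF , lenF)

cherry-reduction : ∀ {G x y p} → TwoCuttableNetwork G → CherryAt G x y p → ReducesTo G (reduceCherry G x)
cherry-reduction iv cd = CherryReduction.result _ _ _ _ iv cd

ret-cherry-reduction : ∀ {G x y u v} → TwoCuttableNetwork G → IsRetCherryVia G x y u v →
  ReducesTo G (reduceRetCherry G u v)
ret-cherry-reduction iv (xy , lfx , lfy , uv , inu , inv , axu , auv , avy , oc) =
  RetCherryReduction.result _ _ _ _ _ iv xy lfx lfy uv inu inv axu auv avy oc

leaf∈leaves : ∀ {G z} → Leaf G z → z ∈ leaves G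
leaf∈leaves {G} (m , d) = ∈-filter⁺ {λ v → deg G v ≡ᵇ 1} (V G) m (subst (λ k → (k ≡ᵇ 1) ≡ true) (sym d) refl)

three-leaves⇒≤ᵇ : ∀ G a b c → Unique (V G) → Leaf G a → Leaf G b → Leaf G c → a ≢ b → a ≢ c → b ≢ c →
  (3 ≤ᵇ length (leaves G)) ≡ true
three-leaves⇒≤ᵇ G a b c uV la lb lc ab ac bc =
  Equivalence.to T-≡ (≤⇒≤ᵇ (unique-sub-length≤ (a ∷ b ∷ c ∷ []) (leaves G) u sub))
  where
  u : Unique (a ∷ b ∷ c ∷ [])
  u = uniq-cons (λ { (here e) → ab e ; (there (here e)) → ac e }) (uniq-cons (λ { (here e) → bc e }) (uniq-cons (λ ()) uniq-nil))
  sub : Sub (a ∷ b ∷ c ∷ []) (leaves G)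
  sub z (here refl) = leaf∈leaves la
  sub z (there (here refl)) = leaf∈leaves lb
  sub z (there (there (here refl))) = leaf∈leaves lc

-- Searching for a cherry or a reticulated cherry

data Reducible (G : Graph) : Set where
  single-edge : ∀ x r → Leaf G x → Leaf G r → adj G x r ≡ true → Reducible G
  cherry : ∀ x y p → CherryAt G x y p → Reducible G
  ret-cherry : ∀ x y u v → IsRetCherryVia G x y u v → Reducible G

-- The search invariant: r s … is a simple path, its first edge s r is a cut-edge and r has
-- degree 3. The leaf x0 on the path guarantees that any cherry found off the path is one
-- of at least three leaves.

record CutPath (G : Graph) : Set where
  constructor mkCutPath
  field
    r s : ℕ
    rest : List ℕ
    cp-simple : SimplePath G (r ∷ s ∷ rest)
    cut-sr : CutEdge G s r
    deg-r : deg G r ≡ 3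
    x0 : ℕ
    x0∈path : x0 ∈ r ∷ s ∷ rest
    x0-leaf : Leaf G x0

pathOf : ∀ {G} → CutPath G → List ℕ
pathOf S = CutPath.r S ∷ CutPath.s S ∷ CutPath.rest S

data Progress (G : Graph) (n : ℕ) : Set where
  found : Reducible G → Progress G n
  longer : (S : CutPath G) → n < length (pathOf S) → Progress G n

module Search (G : Graph) (iv : TwoCuttableNetwork G) (S : CutPath G) where
  open CutPath S
  open IsNetwork (net iv)
  pn = network⇒simpleConnected (net iv)
  P : List ℕ
  P = r ∷ s ∷ rest
  n0 : ℕ
  n0 = length P
  con = connected
  sy = symmetric
  iV = inV

  progress-to : ∀ r2 s2 rest2 → SimplePath G (r2 ∷ s2 ∷ rest2) → CutEdge G s2 r2 → deg G r2 ≡ 3 →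
    x0 ∈ r2 ∷ s2 ∷ rest2 → n0 < length (r2 ∷ s2 ∷ rest2) → Progress G n0
  progress-to r2 s2 rest2 sp cut d m lt = longer (mkCutPath r2 s2 rest2 sp cut d x0 m x0-leaf) lt

  -- h is adjacent to z further along its extension, closing a cycle of degree-3 vertices. The
  -- two adjacent cycle vertices given by 2-cuttability carry cut-edges leaving the cycle; their
  -- far ends are leaves (a reticulated cherry) unless one of them starts a longer cut-path.
  module CycleAhead (h q1 : ℕ) (Q1 : List ℕ) (z : ℕ) (B : List ℕ)
    (sp : SimplePath G (h ∷ q1 ∷ Q1 ++ z ∷ B)) (d3 : ∀ w → w ∈ h ∷ q1 ∷ Q1 ++ z ∷ [] → deg G w ≡ 3)
    (lenB : n0 ≤ length B) (x0B : x0 ∈ B) (ehz : adj G h z ≡ true) where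
    C = h ∷ q1 ∷ Q1 ++ z ∷ []
    ws = q1 ∷ Q1 ++ z ∷ []
    L = h ∷ q1 ∷ Q1 ++ z ∷ B
    eqCL : C ++ B ≡ L
    eqCL = cong (λ q → h ∷ q1 ∷ q) (++-assoc Q1 (z ∷ []) B)
    spCB : SimplePath G (C ++ B)
    spCB = subst (SimplePath G) (sym eqCL) sp
    cyc : SimpleCycle G h ws
    cyc = path-closing-cycle sy h (q1 ∷ Q1) z B (s≤s z≤n) sp ehz
    spCC : SimplePath G C
    spCC = cyP cyc
    eqGen : ∀ {c c2} C1 C2 Y1 Y2 → C ≡ C1 ++ c ∷ C2 → B ≡ Y1 ++ c2 ∷ Y2 → C ++ B ≡ C1 ++ c ∷ (C2 ++ Y1) ++ c2 ∷ Y2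
    eqGen {c} {c2} C1 C2 Y1 Y2 eC eB = trans (cong (_++ B) eC) (trans (cong ((C1 ++ c ∷ C2) ++_) eB)
      (trans (++-assoc C1 (c ∷ C2) (Y1 ++ c2 ∷ Y2)) (cong (λ q → C1 ++ c ∷ q) (sym (++-assoc C2 Y1 (c2 ∷ Y2))))))
    Partner : ℕ → Set
    Partner c = Progress G n0 ⊎ (Σ ℕ λ c2 → Leaf G c2 × adj G c c2 ≡ true × c2 ∉ L)
    cut-into-tail : ∀ {c c2} → c ∈ C → c2 ∈ B → CutEdge G c c2 → Progress G n0
    cut-into-tail {c} {c2} mc mB cut with ∈-∃++ mB | ∈-∃++ mc
    ... | [] , Y2 , eB | C1 , [] , eC = progress-to c c2 Y2 sp2 (cut-edge-swap G c c2 pn cut) (d3 c mc) x0m lt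
      where
      sp2 : SimplePath G (c ∷ c2 ∷ Y2)
      sp2 = sp-suffix C1 (c ∷ c2 ∷ Y2) (subst (SimplePath G) (eqGen C1 [] [] Y2 eC eB) spCB)
      x0m : x0 ∈ c ∷ c2 ∷ Y2
      x0m = there (subst (x0 ∈_) eB x0B)
      lt : n0 < length (c ∷ c2 ∷ Y2)
      lt = s≤s (subst (λ q → n0 ≤ length q) eB lenB)
    ... | y ∷ Y1 , Y2 , eB | C1 , [] , eC =
      ⊥-elim (no-cut-between-path-vertices G C1 c y Y1 c2 Y2 con sy iV (subst (SimplePath G) (eqGen C1 [] (y ∷ Y1) Y2 eC eB) spCB) cut)
    ... | Y1 , Y2 , eB | C1 , x ∷ C2 , eC =
      ⊥-elim (no-cut-between-path-vertices G C1 c x (C2 ++ Y1) c2 Y2 con sy iV (subst (SimplePath G) (eqGen C1 (x ∷ C2) Y1 Y2 eC eB) spCB) cut)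

    cut-off-path : ∀ {c c2} → c ∈ C → c2 ∉ L → CutEdge G c c2 → Partner c
    cut-off-path {c} {c2} mc nL cut with ∈-∃++ mc | deg G c2 ≟ 1
    ... | _ | yes d1 = inj₂ (c2 , (inV-target iV sy c c2 (proj₁ cut) , d1) , proj₁ cut , nL)
    ... | C1 , C2 , eC | no d1 = inj₁ (progress-to c2 c (C2 ++ B) sp2 cut (non-leaf⇒deg3 (net iv) c2V d1) (there (there (∈++r C2 B x0B))) lt)
      where
      c2V : c2 ∈ V G
      c2V = inV-target iV sy c c2 (proj₁ cut)
      eq1 : C ++ B ≡ C1 ++ c ∷ C2 ++ B
      eq1 = trans (cong (_++ B) eC) (++-assoc C1 (c ∷ C2) B)
      sp1 : SimplePath G (c ∷ C2 ++ B)
      sp1 = sp-suffix C1 (c ∷ C2 ++ B) (subst (SimplePath G) eq1 spCB)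
      sp2 : SimplePath G (c2 ∷ c ∷ C2 ++ B)
      sp2 = sp-cons c2 c (C2 ++ B) sp1 (λ m → nL (subst (c2 ∈_) eqCL (subst (c2 ∈_) (sym eq1) (∈++r C1 _ m)))) c2V
              (trans (sy c2 c) (proj₁ cut))
      lt : n0 < length (c2 ∷ c ∷ C2 ++ B)
      lt = s≤s (≤-trans lenB (≤-trans (m≤n+m (length B) (length C2)) (≤-trans (≤-reflexive (sym (length-++ C2 {B}))) (n≤1+n _))))

    partner : ∀ c → c ∈ C → IncidentToCutEdge G c → Partner c
    partner c mc (c2 , cut) with c2 ∈? C | c2 ∈? L
    ... | yes m | _ = ⊥-elim (cycle-edge-not-cut con sy iV cyc mc m (adj⇒≢ pn c c2 (proj₁ cut)) cut)
    ... | no nC | yes mL = inj₁ (cut-into-tail mc ([ (λ m → ⊥-elim (nC m)) , (λ m → m) ] (∈++ C B (subst (c2 ∈_) (sym eqCL) mL))) cut)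
    ... | no _ | no nL = cut-off-path mc nL cut

    resolve : Progress G n0
    resolve with tcut iv h ws (SimpleCycle⇒Cycle cyc)
    ... | a , b , cs , ia , ib with consec-∈ (closed h ws) a b cs
    ... | ma0 , mb0 with partner a (closed-∈ h ws a ma0) ia
    ... | inj₁ o = o
    ... | inj₂ (a2 , la2 , ea , na) with partner b (closed-∈ h ws b mb0) ib
    ... | inj₁ o = o
    ... | inj₂ (b2 , lb2 , eb , nb) =
      found (ret-cherry a2 b2 a b (a2b2 , la2 , lb2 , ab , inta , intb , trans (sy a2 a) ea , eab , eb ,
                              (h , ws , SimpleCycle⇒Cycle cyc , inj₁ cs)))
      where
      eab : adj G a b ≡ true
      eab = consec-adj (closed h ws) a b cs (proj₂ (proj₂ (proj₂ (SimpleCycle⇒Cycle cyc))))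
      ab : a ≢ b
      ab = adj⇒≢ pn a b eab
      ma : a ∈ C
      ma = closed-∈ h ws a ma0
      mb : b ∈ C
      mb = closed-∈ h ws b mb0
      inta : Internal G a
      inta = deg3⇒Internal G (spV spCC a ma) (d3 a ma)
      intb : Internal G b
      intb = deg3⇒Internal G (spV spCC b mb) (d3 b mb)
      a2b2 : a2 ≢ b2
      a2b2 refl = two-neighbours⇒non-leaf (adj⇒Nbr pn a2 a (trans (sy a2 a) ea)) (adj⇒Nbr pn a2 b (trans (sy a2 b) eb)) ab (proj₂ la2)

  Extension : List ℕ → Set
  Extension Q = SimplePath G (Q ++ P) × (∀ w → w ∈ Q → deg G w ≡ 3)

  len-suffix : ∀ Q → n0 ≤ length (Q ++ P)
  len-suffix Q = subst (n0 ≤_) (sym (length-++ Q {P})) (m≤n+m n0 (length Q))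

  close-cycle : ∀ h Q1 x Q2 → Q1 ≢ [] → Extension (h ∷ Q1 ++ x ∷ Q2) → adj G h x ≡ true → Progress G n0
  close-cycle h [] x Q2 ne _ _ = ⊥-elim (ne refl)
  close-cycle h (q1 ∷ Q1) x Q2 _ (sp , d3) e = CycleAhead.resolve h q1 Q1 x (Q2 ++ P) sp2 d3b (len-suffix Q2) (∈++r Q2 P x0∈path) e
    where
    eq : (h ∷ q1 ∷ Q1 ++ x ∷ Q2) ++ P ≡ h ∷ q1 ∷ Q1 ++ x ∷ Q2 ++ P
    eq = cong (λ q → h ∷ q1 ∷ q) (++-assoc Q1 (x ∷ Q2) P)
    sp2 : SimplePath G (h ∷ q1 ∷ Q1 ++ x ∷ Q2 ++ P)
    sp2 = subst (SimplePath G) eq sp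
    d3b : ∀ w → w ∈ h ∷ q1 ∷ Q1 ++ x ∷ [] → deg G w ≡ 3
    d3b w (here refl) = d3 w (here refl)
    d3b w (there (here refl)) = d3 w (there (here refl))
    d3b w (there (there m)) with ∈++ Q1 (x ∷ []) m
    ... | inj₁ m1 = d3 w (there (there (∈++l Q1 (x ∷ Q2) m1)))
    ... | inj₂ (here refl) = d3 w (there (there (∈++r Q1 (x ∷ Q2) (here refl))))

  successor : ∀ Q → Σ ℕ λ p1 → Σ (List ℕ) λ T → Q ++ P ≡ p1 ∷ T
  successor [] = r , s ∷ rest , refl
  successor (q ∷ Q) = q , Q ++ P , refl

  sr-ne : s ≢ r
  sr-ne = adj⇒≢ pn s r (proj₁ cut-sr)

  no-edge-into-P : ∀ h Q x → SimplePath G (h ∷ Q ++ P) → x ∈ s ∷ rest → adj G h x ≡ true → ⊥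
  no-edge-into-P h Q x sp m e with ∈-∃++ m
  ... | R1 , R2 , eR = cycle-edge-not-cut con sy iV cyc (s∈ (head-∈-prefix R1 eR)) r∈ sr-ne cut-sr
    where
    K = Q ++ r ∷ R1
    sp′ : SimplePath G (h ∷ K ++ x ∷ R2)
    sp′ = subst (SimplePath G) (cong (h ∷_) (trans (cong (λ q → Q ++ r ∷ q) eR) (sym (++-assoc Q (r ∷ R1) (x ∷ R2))))) sp
    K≢[] : 1 ≤ length K
    K≢[] = subst (1 ≤_) (sym (length-++ Q)) (≤-trans (s≤s z≤n) (m≤n+m _ (length Q)))
    cyc : SimpleCycle G h (K ++ x ∷ [])
    cyc = path-closing-cycle sy h K x R2 K≢[] sp′ e
    r∈ : r ∈ h ∷ K ++ x ∷ []
    r∈ = there (∈++l K (x ∷ []) (∈-insert Q))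
    s∈ : s ∈ R1 ⊎ s ≡ x → s ∈ h ∷ K ++ x ∷ []
    s∈ (inj₁ m1) = there (∈++l K (x ∷ []) (∈++r Q (r ∷ R1) (there m1)))
    s∈ (inj₂ refl) = there (∈++r K (x ∷ []) (here refl))

  data Kind (Lh : List ℕ) (x : ℕ) : Set where
    settled : Progress G n0 → Kind Lh x
    is-r : x ≡ r → Kind Lh x
    off-path : x ∉ Lh → Kind Lh x

  classify : ∀ h Q x → Extension (h ∷ Q) → adj G h x ≡ true → x ≢ proj₁ (successor Q) → Kind (h ∷ Q ++ P) x
  classify h Q x ex e xp with x ∈? (h ∷ Q ++ P)
  ... | no nm = off-path nm
  ... | yes (here refl) = ⊥-elim (adj⇒≢ pn x x e refl)
  ... | yes (there m) with ∈++ Q P m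
  ... | inj₂ (here refl) = is-r refl
  ... | inj₂ (there mS) = ⊥-elim (no-edge-into-P h Q x (proj₁ ex) mS e)
  ... | inj₁ mQ with ∈-∃++ mQ
  ... | [] , Q2 , refl = ⊥-elim (xp refl)
  ... | q1 ∷ Q1 , Q2 , refl = settled (close-cycle h (q1 ∷ Q1) x Q2 (λ ()) ex e)

  Stuck : ℕ → List ℕ → Set
  Stuck h Q = ∀ w → adj G h w ≡ true → w ∈ h ∷ Q ++ P ⊎ deg G w ≡ 1

  find-first : (L : List ℕ) (Pd : ℕ → Set) → (∀ w → Dec (Pd w)) → (Σ ℕ λ w → w ∈ L × Pd w) ⊎ (∀ w → w ∈ L → Pd w → ⊥)
  find-first [] Pd d = inj₂ (λ w ())
  find-first (x ∷ L) Pd d with d x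
  ... | yes p = inj₁ (x , here refl , p)
  ... | no np with find-first L Pd d
  ... | inj₁ (w , m , p) = inj₁ (w , there m , p)
  ... | inj₂ f = inj₂ g
    where
    g : ∀ w → w ∈ x ∷ L → Pd w → ⊥
    g w (here refl) p = np p
    g w (there m) p = f w m p

  find-extension : ∀ h Q → (Σ ℕ λ w → w ∉ h ∷ Q ++ P × adj G h w ≡ true × (deg G w ≡ 1 → ⊥)) ⊎ Stuck h Q
  find-extension h Q with find-first (neighbours G h) (λ w → (w ∉ h ∷ Q ++ P) × (deg G w ≡ 1 → ⊥)) dec
    where
    dec : ∀ w → Dec ((w ∉ h ∷ Q ++ P) × (deg G w ≡ 1 → ⊥))
    dec w with w ∈? (h ∷ Q ++ P)
    ... | yes m = no (λ (nm , _) → nm m)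
    ... | no nm with deg G w ≟ 1
    ... | yes d = no (λ (_ , nd) → nd d)
    ... | no nd = yes (nm , nd)
  ... | inj₁ (w , mN , nm , nd) = inj₁ (w , nm , proj₂ (∈-neighbours⁻ G h w mN) , nd)
  ... | inj₂ f = inj₂ st
    where
    st : Stuck h Q
    st w e with w ∈? (h ∷ Q ++ P)
    ... | yes m = inj₁ m
    ... | no nm with deg G w ≟ 1
    ... | yes d = inj₂ d
    ... | no nd = ⊥-elim (f w (∈-neighbours⁺ G h w (inV-target iV sy h w e) e) (nm , nd))

  record MaximalExtension (h : ℕ) (Q : List ℕ) : Set where
    constructor mkMax
    field
      maxHead : ℕ
      maxTail : List ℕ
      added : List ℕ
      max≡ : maxHead ∷ maxTail ≡ added ++ h ∷ Q
      maxExt : Extension (maxHead ∷ maxTail)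
      maxStuck : Stuck maxHead maxTail

  NV : ℕ
  NV = length (V G)

  extend-maximally : ∀ k h Q → Extension (h ∷ Q) → NV ≤ length (h ∷ Q ++ P) + k → MaximalExtension h Q
  extend-maximally k h Q ex bd with find-extension h Q
  ... | inj₂ st = mkMax h Q [] refl ex st
  extend-maximally zero h Q ex bd | inj₁ (w , nw , e , nd) =
    ⊥-elim (n≮n (length (h ∷ Q ++ P)) (≤-trans (simplePath-length≤ (w ∷ h ∷ Q ++ P) uniqueV sp2) (subst (NV ≤_) (+-identityʳ _) bd)))
    where
    sp2 : SimplePath G (w ∷ h ∷ Q ++ P)
    sp2 = sp-cons w h (Q ++ P) (proj₁ ex) nw (inV-target iV sy h w e) (trans (sy w h) e)
  extend-maximally (suc k) h Q ex bd | inj₁ (w , nw , e , nd) with extend-maximally k w (h ∷ Q) ex2 bd2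
    where
    wV : w ∈ V G
    wV = inV-target iV sy h w e
    ex2 : Extension (w ∷ h ∷ Q)
    ex2 = sp-cons w h (Q ++ P) (proj₁ ex) nw wV (trans (sy w h) e) , d3
      where
      d3 : ∀ v → v ∈ w ∷ h ∷ Q → deg G v ≡ 3
      d3 v (here refl) = non-leaf⇒deg3 (net iv) wV nd
      d3 v (there m) = proj₂ ex v m
    bd2 : NV ≤ length (w ∷ h ∷ Q ++ P) + k
    bd2 = subst (NV ≤_) (+-suc (length (h ∷ Q ++ P)) k) bd
  ... | mkMax maxHead maxTail added max≡ maxExt maxStuck = mkMax maxHead maxTail (added ++ w ∷ []) (trans max≡ (sym (++-assoc added (w ∷ []) (h ∷ Q)))) maxExt maxStuck

  record ReturnsToR (h : ℕ) (Q : List ℕ) : Set where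
    constructor mkReturn
    field
      head-r : adj G h r ≡ true
      pendant : ℕ
      pendant-leaf : Leaf G pendant
      head-pendant : adj G h pendant ≡ true
      extended : Q ≢ []

  nonempty-of : ∀ Q x → x ≡ r → x ≢ proj₁ (successor Q) → Q ≢ []
  nonempty-of [] x e ne refl = ne e
  nonempty-of (q ∷ Q) x e ne ()

  x0-in : ∀ h Q → x0 ∈ h ∷ Q ++ P
  x0-in h Q = there (∈++r Q P x0∈path)

  cherry-at : ∀ h Q α β → α ≢ β → Leaf G α → Leaf G β → adj G h α ≡ true → adj G h β ≡ true →
    α ∉ h ∷ Q ++ P → β ∉ h ∷ Q ++ P → Progress G n0
  cherry-at h Q α β ne la lb ea eb na nb =
    found (cherry α β h (mkCherryAt ne la lb (trans (sy α h) ea) (trans (sy β h) eb)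
      (three-leaves⇒≤ᵇ G α β x0 uniqueV la lb x0-leaf ne (λ e → na (subst (_∈ h ∷ Q ++ P) (sym e) (x0-in h Q)))
        (λ e → nb (subst (_∈ h ∷ Q ++ P) (sym e) (x0-in h Q))))))

  -- The two neighbours of a stuck head besides its successor lie on its own extension (closing
  -- a cycle), are r, or are fresh leaves; further along P they would put the cut-edge s r on a cycle.
  analyse : ∀ h Q → Extension (h ∷ Q) → Stuck h Q → Progress G n0 ⊎ ReturnsToR h Q
  analyse h Q ex st = combine (classify h Q α ex (nbrAdj (Others.o1N O)) (Others.o1p O))
                           (classify h Q β ex (nbrAdj (Others.o2N O)) (Others.o2p O))
    where
    p1 = proj₁ (successor Q)
    ehp : adj G h p1 ≡ true
    ehp = proj₁ (subst (λ L → ChainAdj G (h ∷ L)) (proj₂ (proj₂ (successor Q))) (spC (proj₁ ex)))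
    D3h = deg3-view G h uniqueV (proj₂ ex h (here refl))
    O = others D3h (adj⇒Nbr pn h p1 ehp)
    α = Others.o1 O
    β = Others.o2 O
    Lh = h ∷ Q ++ P
    leafOf : ∀ x → x ∉ Lh → adj G h x ≡ true → Leaf G x
    leafOf x nm e with st x e
    ... | inj₁ m = ⊥-elim (nm m)
    ... | inj₂ d = inV-target iV sy h x e , d
    combine : Kind Lh α → Kind Lh β → Progress G n0 ⊎ ReturnsToR h Q
    combine (settled o) _ = inj₁ o
    combine (is-r _) (settled o) = inj₁ o
    combine (off-path _) (settled o) = inj₁ o
    combine (is-r e1) (is-r e2) = ⊥-elim (Others.o12 O (trans e1 (sym e2)))
    combine (is-r e1) (off-path n2) = inj₂ (mkReturn (subst (λ q → adj G h q ≡ true) e1 (nbrAdj (Others.o1N O))) β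
                                   (leafOf β n2 (nbrAdj (Others.o2N O))) (nbrAdj (Others.o2N O))
                                   (nonempty-of Q α e1 (Others.o1p O)))
    combine (off-path n1) (is-r e2) = inj₂ (mkReturn (subst (λ q → adj G h q ≡ true) e2 (nbrAdj (Others.o2N O))) α
                                   (leafOf α n1 (nbrAdj (Others.o1N O))) (nbrAdj (Others.o1N O))
                                   (nonempty-of Q β e2 (Others.o2p O)))
    combine (off-path n1) (off-path n2) = inj₁ (cherry-at h Q α β (Others.o12 O) (leafOf α n1 (nbrAdj (Others.o1N O)))
                                 (leafOf β n2 (nbrAdj (Others.o2N O))) (nbrAdj (Others.o1N O)) (nbrAdj (Others.o2N O)) n1 n2)

  rev-head : ∀ x L → Σ (List ℕ) λ T → rev (x ∷ L) ≡ lastOf x L ∷ T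
  rev-head x [] = [] , refl
  rev-head x (y ∷ L) with rev-head y L
  ... | T , e = T ++ x ∷ [] , cong (_++ x ∷ []) e

  rev-last : ∀ x L h T → rev (x ∷ L) ≡ h ∷ T → lastOf h T ≡ x
  rev-last x L h T e = snoc-last (rev L) x h T e

  reverse-extension : ∀ h Q → SimplePath G ((h ∷ Q) ++ P) → adj G h r ≡ true → SimplePath G (rev (h ∷ Q) ++ P)
  reverse-extension h Q sp e with rev-head h Q | uniq++⁻ (h ∷ Q) P (spU sp)
  ... | T , eqr | uK , uP , dj = mkSP hV u ch
    where
    K = h ∷ Q
    spK = sp-prefix K P sp
    spR = simplePath-reverse sy K spK
    spPP = sp-suffix K P sp
    hV : ∀ z → z ∈ rev K ++ P → z ∈ V G
    hV z m with ∈++ (rev K) P m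
    ... | inj₁ m1 = spV spK z (∈-rev⁻ K m1)
    ... | inj₂ m2 = spV spPP z m2
    u : Unique (rev K ++ P)
    u = uniq++⁺ (rev K) P (spU spR) uP (λ z m1 m2 → dj z (∈-rev⁻ K m1) m2)
    ch : ChainAdj G (rev K ++ P)
    ch = subst (λ q → ChainAdj G (q ++ P)) (sym eqr)
           (chain-++ (lastOf h Q) T r (s ∷ rest) (subst (ChainAdj G) eqr (spC spR)) (spC spPP)
             (subst (λ q → adj G q r ≡ true) (sym (rev-last h Q (lastOf h Q) T eqr)) e))

  module NeighboursOfR (y1 h2 : ℕ) (ry1 : adj G r y1 ≡ true) (rh2 : adj G r h2 ≡ true) (sy1 : s ≢ y1) (sh2 : s ≢ h2) (y1h2 : y1 ≢ h2) where
    ers : adj G r s ≡ true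
    ers = trans (sy r s) (proj₁ cut-sr)
    D3r = deg3-view G r uniqueV deg-r
    Tr = third D3r (adj⇒Nbr pn r s ers) (adj⇒Nbr pn r y1 ry1) sy1
    r-neighbours : ∀ z → adj G r z ≡ true → z ≡ s ⊎ z ≡ y1 ⊎ z ≡ h2
    r-neighbours z e with Third.only3 Tr h2 (adj⇒Nbr pn r h2 rh2) | Third.only3 Tr z (adj⇒Nbr pn r z e)
    ... | inj₁ x | _ = ⊥-elim (sh2 (sym x))
    ... | inj₂ (inj₁ x) | _ = ⊥-elim (y1h2 (sym x))
    ... | inj₂ (inj₂ _) | inj₁ x = inj₁ x
    ... | inj₂ (inj₂ _) | inj₂ (inj₁ x) = inj₂ (inj₁ x)
    ... | inj₂ (inj₂ x) | inj₂ (inj₂ y) = inj₂ (inj₂ (trans y (sym x)))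

  full-fuel : ∀ h Q → NV ≤ length (h ∷ Q ++ P) + NV
  full-fuel h Q = m≤n+m NV _

  extension-internal : ∀ h Q → Extension (h ∷ Q) → ∀ w → w ∈ h ∷ Q → Internal G w
  extension-internal h Q ex w m = deg3⇒Internal G (spV (proj₁ ex) w (∈++l (h ∷ Q) P m)) (proj₂ ex w m)

  handle-return : ∀ {h Q} → Progress G n0 ⊎ ReturnsToR h Q → (ReturnsToR h Q → Progress G n0) → Progress G n0
  handle-return (inj₁ o) _ = o
  handle-return (inj₂ ret) k = k ret

  -- y1 is stuck as well, next to r and a fresh leaf ℓ1. If the third neighbour t2 of y2 is a
  -- fresh leaf, ℓ1 y1 y2 t2 is a reticulated cherry on the cycle y1 y2 … r; otherwise the
  -- search goes on from t2, and a head next to r can then only be y1, closing a cycle.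
  module SecondReturn (h2 : ℕ) (Q2 : List ℕ) (y1 y2 y3 : ℕ) (T2 : List ℕ)
    (eqr : rev (h2 ∷ Q2) ≡ y1 ∷ y2 ∷ y3 ∷ T2) (exR : Extension (y1 ∷ y2 ∷ y3 ∷ T2))
    (ret1 : ReturnsToR y1 (y2 ∷ y3 ∷ T2)) (ry1 : adj G r y1 ≡ true) (rh2 : adj G r h2 ≡ true)
    (sy1 : s ≢ y1) (sh2 : s ≢ h2) (y1h2 : y1 ≢ h2) where
    open NeighboursOfR y1 h2 ry1 rh2 sy1 sh2 y1h2
    ℓ1 = ReturnsToR.pendant ret1
    spR = proj₁ exR
    uR = spU spR
    e12 : adj G y1 y2 ≡ true
    e12 = proj₁ (spC spR)
    e23 : adj G y2 y3 ≡ true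
    e23 = proj₁ (proj₂ (spC spR))
    y1y3 : y1 ≢ y3
    y1y3 e = uniq-head uR (there (here e))
    hm : h2 ∈ y3 ∷ T2
    hm = subst (_∈ y3 ∷ T2) (rev-last h2 Q2 y1 (y2 ∷ y3 ∷ T2) eqr) (lastOf-∈ y3 T2)
    exL3 : Extension (y2 ∷ y3 ∷ T2)
    exL3 = sp-tail _ spR , λ w m → proj₂ exR w (there m)
    Ty = third (deg3-view G y2 uniqueV (proj₂ exR y2 (there (here refl))))
               (adj⇒Nbr pn y2 y1 (trans (sy y2 y1) e12)) (adj⇒Nbr pn y2 y3 e23) y1y3
    t2 = Third.q Ty
    e2t : adj G y2 t2 ≡ true
    e2t = nbrAdj (Third.qN Ty)
    t2V : t2 ∈ V G
    t2V = nbrV (Third.qN Ty)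
    y2∉ : y2 ∉ (y3 ∷ T2) ++ P
    y2∉ = uniq-head (uniq-tail uR)

    t2≢r : t2 ≢ r
    t2≢r e with r-neighbours y2 (trans (sy r y2) (subst (λ q → adj G y2 q ≡ true) e e2t))
    ... | inj₁ x = y2∉ (subst (_∈ (y3 ∷ T2) ++ P) (sym x) (∈++r (y3 ∷ T2) P (there (here refl))))
    ... | inj₂ (inj₁ x) = adj⇒≢ pn y1 y2 e12 (sym x)
    ... | inj₂ (inj₂ x) = y2∉ (∈++l (y3 ∷ T2) P (subst (_∈ y3 ∷ T2) (sym x) hm))

    t2-leaf : deg G t2 ≡ 1 → Progress G n0
    t2-leaf d = found (ret-cherry ℓ1 t2 y1 y2 (ℓ1≢t2 , ReturnsToR.pendant-leaf ret1 , (t2V , d) , adj⇒≢ pn y1 y2 e12 ,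
                  extension-internal y1 _ exR y1 (here refl) , extension-internal y1 _ exR y2 (there (here refl)) ,
                  trans (sy _ y1) (ReturnsToR.head-pendant ret1) , e12 , e2t ,
                  (y1 , _ , SimpleCycle⇒Cycle cyc , inj₁ (inj₁ (refl , refl)))))
      where
      ℓ1≢t2 : ℓ1 ≢ t2
      ℓ1≢t2 e = two-neighbours⇒non-leaf
        (adj⇒Nbr pn t2 y1 (trans (sy t2 y1) (subst (λ q → adj G y1 q ≡ true) e (ReturnsToR.head-pendant ret1))))
        (adj⇒Nbr pn t2 y2 (trans (sy t2 y2) e2t)) (adj⇒≢ pn y1 y2 e12) d
      cyc : SimpleCycle G y1 ((y2 ∷ y3 ∷ T2) ++ r ∷ [])
      cyc = path-closing-cycle sy y1 (y2 ∷ y3 ∷ T2) r (s ∷ rest) (s≤s z≤n) spR (ReturnsToR.head-r ret1)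

    t2-extends : t2 ∉ y2 ∷ (y3 ∷ T2) ++ P → (deg G t2 ≡ 1 → ⊥) → Progress G n0
    t2-extends nm nd = settle (extend-maximally NV t2 (y2 ∷ y3 ∷ T2) ex4 (full-fuel t2 (y2 ∷ y3 ∷ T2)))
      where
      ex4 : Extension (t2 ∷ y2 ∷ y3 ∷ T2)
      ex4 = sp-cons t2 y2 ((y3 ∷ T2) ++ P) (proj₁ exL3) nm t2V (trans (sy t2 y2) e2t) ,
            λ { w (here refl) → non-leaf⇒deg3 (net iv) t2V nd ; w (there m) → proj₂ exL3 w m }
      t2-not-next-to-r : t2 ≡ s ⊎ t2 ≡ y1 ⊎ t2 ≡ h2 → ⊥
      t2-not-next-to-r (inj₁ x) = nm (subst (_∈ y2 ∷ (y3 ∷ T2) ++ P) (sym x) (there (∈++r (y3 ∷ T2) P (there (here refl)))))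
      t2-not-next-to-r (inj₂ (inj₁ x)) = Third.qx Ty x
      t2-not-next-to-r (inj₂ (inj₂ x)) = nm (subst (_∈ y2 ∷ (y3 ∷ T2) ++ P) (sym x) (there (∈++l (y3 ∷ T2) P hm)))
      settle : MaximalExtension t2 (y2 ∷ y3 ∷ T2) → Progress G n0
      settle (mkMax _ _ [] refl maxExt maxStuck) =
        handle-return (analyse t2 (y2 ∷ y3 ∷ T2) maxExt maxStuck)
          (λ ret → ⊥-elim (t2-not-next-to-r (r-neighbours t2 (trans (sy r t2) (ReturnsToR.head-r ret)))))
      settle (mkMax _ _ (e ∷ E2) refl maxExt maxStuck) =
        handle-return (analyse e (E2 ++ t2 ∷ y2 ∷ y3 ∷ T2) maxExt maxStuck)
          (λ ret → e-next-to-r (r-neighbours e (trans (sy r e) (ReturnsToR.head-r ret))))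
        where
        Lg = (E2 ++ t2 ∷ y2 ∷ y3 ∷ T2) ++ P
        e∉ : e ∉ Lg
        e∉ = uniq-head (spU (proj₁ maxExt))
        e-next-to-r : e ≡ s ⊎ e ≡ y1 ⊎ e ≡ h2 → Progress G n0
        e-next-to-r (inj₁ x) = ⊥-elim (e∉ (subst (_∈ Lg) (sym x) (∈++r (E2 ++ t2 ∷ y2 ∷ y3 ∷ T2) P (there (here refl)))))
        e-next-to-r (inj₂ (inj₂ x)) =
          ⊥-elim (e∉ (subst (_∈ Lg) (sym x) (∈++l (E2 ++ t2 ∷ y2 ∷ y3 ∷ T2) P (∈++r E2 (t2 ∷ y2 ∷ y3 ∷ T2) (there (there hm))))))
        e-next-to-r (inj₂ (inj₁ x)) =
          close-cycle e (E2 ++ t2 ∷ []) y2 (y3 ∷ T2) (snoc≢[] E2 t2)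
            (subst (λ q → Extension (e ∷ q)) (sym (++-assoc E2 (t2 ∷ []) (y2 ∷ y3 ∷ T2))) maxExt)
            (subst (λ q → adj G q y2 ≡ true) (sym x) e12)

    resolve : Progress G n0
    resolve = by-kind (classify y2 (y3 ∷ T2) t2 exL3 e2t (Third.qy Ty))
      where
      by-kind : Kind (y2 ∷ (y3 ∷ T2) ++ P) t2 → Progress G n0
      by-kind (settled o) = o
      by-kind (is-r e) = ⊥-elim (t2≢r e)
      by-kind (off-path nm) with deg G t2 ≟ 1
      ... | yes d = t2-leaf d
      ... | no nd = t2-extends nm nd

  second-return : ∀ h2 Q2 → ReturnsToR h2 Q2 → ∀ y1 T → rev (h2 ∷ Q2) ≡ y1 ∷ T → Extension (y1 ∷ T) → ReturnsToR y1 T →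
    adj G r y1 ≡ true → adj G r h2 ≡ true → s ≢ y1 → s ≢ h2 → y1 ≢ h2 → Progress G n0
  second-return h2 Q2 ret2 y1 [] eqr exR ret1 ry1 rh2 sy1 sh2 y1h2 = ⊥-elim (y1h2 (rev-last h2 Q2 y1 [] eqr))
  second-return h2 Q2 ret2 y1 (y2 ∷ y3 ∷ T2) eqr exR ret1 ry1 rh2 sy1 sh2 y1h2 =
    SecondReturn.resolve h2 Q2 y1 y2 y3 T2 eqr exR ret1 ry1 rh2 sy1 sh2 y1h2
  second-return h2 Q2 ret2 y1 (y2 ∷ []) eqr exR ret1 ry1 rh2 sy1 sh2 y1h2 with rev-last h2 Q2 y1 (y2 ∷ []) eqr
  ... | refl =
    found (ret-cherry ℓ1 ℓ2 y1 y2 (ℓ1≢ℓ2 , ReturnsToR.pendant-leaf ret1 , ReturnsToR.pendant-leaf ret2 , adj⇒≢ pn y1 y2 e12 ,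
      extension-internal y1 (y2 ∷ []) exR y1 (here refl) , extension-internal y1 (y2 ∷ []) exR y2 (there (here refl)) ,
      trans (sy _ y1) (ReturnsToR.head-pendant ret1) , e12 , ReturnsToR.head-pendant ret2 ,
      (y1 , y2 ∷ r ∷ [] , SimpleCycle⇒Cycle cyc , inj₁ (inj₁ (refl , refl)))))
    where
    ℓ1 = ReturnsToR.pendant ret1
    ℓ2 = ReturnsToR.pendant ret2
    e12 : adj G y1 y2 ≡ true
    e12 = proj₁ (spC (proj₁ exR))
    ℓ1≢ℓ2 : ℓ1 ≢ ℓ2
    ℓ1≢ℓ2 e = two-neighbours⇒non-leaf
      (adj⇒Nbr pn ℓ2 y1 (trans (sy ℓ2 y1) (subst (λ q → adj G y1 q ≡ true) e (ReturnsToR.head-pendant ret1))))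
      (adj⇒Nbr pn ℓ2 y2 (trans (sy ℓ2 y2) (ReturnsToR.head-pendant ret2))) (adj⇒≢ pn y1 y2 e12)
      (proj₂ (ReturnsToR.pendant-leaf ret2))
    cyc : SimpleCycle G y1 (y2 ∷ r ∷ [])
    cyc = path-closing-cycle sy y1 (y2 ∷ []) r (s ∷ rest) (s≤s z≤n) (proj₁ exR) (ReturnsToR.head-r ret1)

  -- h2 is adjacent to r, and so is the first vertex y1 of its extension: r has neighbours
  -- s, y1, h2, and the search restarts from y1 along the reversed extension.
  first-return : ∀ h2 Q2 → Extension (h2 ∷ Q2) → ReturnsToR h2 Q2 → Progress G n0
  first-return h2 Q2 exK ret2 = from-reversed (rev-head h2 Q2)
    where
    y1 = lastOf h2 Q2
    K = h2 ∷ Q2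
    spK = proj₁ exK
    ry1 : adj G r y1 ≡ true
    ry1 = trans (sy r y1) (chain-junction h2 Q2 r (s ∷ rest) (spC spK))
    rh2 : adj G r h2 ≡ true
    rh2 = trans (sy r h2) (ReturnsToR.head-r ret2)
    djK = proj₂ (proj₂ (uniq++⁻ K P (spU spK)))
    sy1 : s ≢ y1
    sy1 e = djK y1 (lastOf-∈ h2 Q2) (subst (_∈ P) e (there (here refl)))
    sh2 : s ≢ h2
    sh2 e = djK h2 (here refl) (subst (_∈ P) e (there (here refl)))
    last≢head : ∀ Q → Q ≢ [] → Unique (h2 ∷ Q ++ P) → lastOf h2 Q ≢ h2
    last≢head [] ne _ = ⊥-elim (ne refl)
    last≢head (q ∷ Q) _ u e = uniq-head u (∈++l (q ∷ Q) P (subst (_∈ q ∷ Q) e (lastOf-∈ q Q)))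
    y1h2 : y1 ≢ h2
    y1h2 = last≢head Q2 (ReturnsToR.extended ret2) (spU spK)
    open NeighboursOfR y1 h2 ry1 rh2 sy1 sh2 y1h2
    from-reversed : Σ (List ℕ) (λ T → rev (h2 ∷ Q2) ≡ y1 ∷ T) → Progress G n0
    from-reversed (T , eqr) = settle (extend-maximally NV y1 T exR (full-fuel y1 T))
      where
      exR : Extension (y1 ∷ T)
      exR = subst (λ q → SimplePath G (q ++ P)) eqr (reverse-extension h2 Q2 spK (ReturnsToR.head-r ret2)) ,
            λ w m → proj₂ exK w (∈-rev⁻ K (subst (w ∈_) (sym eqr) m))
      h2R : h2 ∈ y1 ∷ T
      h2R = subst (h2 ∈_) eqr (∈-rev⁺ K (here refl))
      settle : MaximalExtension y1 T → Progress G n0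
      settle (mkMax _ _ [] refl maxExt maxStuck) =
        handle-return (analyse y1 T maxExt maxStuck)
          (λ ret1 → second-return h2 Q2 ret2 y1 T eqr exR ret1 ry1 rh2 sy1 sh2 y1h2)
      settle (mkMax _ _ (e ∷ E2) refl maxExt maxStuck) =
        handle-return (analyse e (E2 ++ y1 ∷ T) maxExt maxStuck)
          (λ ret → ⊥-elim (e-not-next-to-r (r-neighbours e (trans (sy r e) (ReturnsToR.head-r ret)))))
        where
        Lg = (E2 ++ y1 ∷ T) ++ P
        e∉ : e ∉ Lg
        e∉ = uniq-head (spU (proj₁ maxExt))
        e-not-next-to-r : e ≡ s ⊎ e ≡ y1 ⊎ e ≡ h2 → ⊥
        e-not-next-to-r (inj₁ x) = e∉ (subst (_∈ Lg) (sym x) (∈++r (E2 ++ y1 ∷ T) P (there (here refl))))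
        e-not-next-to-r (inj₂ (inj₁ x)) = e∉ (subst (_∈ Lg) (sym x) (∈++l (E2 ++ y1 ∷ T) P (∈++r E2 (y1 ∷ T) (here refl))))
        e-not-next-to-r (inj₂ (inj₂ x)) = e∉ (subst (_∈ Lg) (sym x) (∈++l (E2 ++ y1 ∷ T) P (∈++r E2 (y1 ∷ T) h2R)))

  explore-from : ∀ h Q → Extension (h ∷ Q) → Progress G n0
  explore-from h Q ex = settle (extend-maximally NV h Q ex (full-fuel h Q))
    where
    settle : MaximalExtension h Q → Progress G n0
    settle (mkMax h′ Q′ _ _ ex′ stuck) = handle-return (analyse h′ Q′ ex′ stuck) (first-return h′ Q′ ex′)

  no-chord-at-r : ∀ x → x ∈ rest → adj G r x ≡ true → ⊥
  no-chord-at-r x m e with ∈-∃++ m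
  ... | R1 , R2 , eR = cycle-edge-not-cut con sy iV cyc (there (here refl)) (here refl) sr-ne cut-sr
    where
    cyc : SimpleCycle G r ((s ∷ R1) ++ x ∷ [])
    cyc = path-closing-cycle sy r (s ∷ R1) x R2 (s≤s z≤n) (subst (λ q → SimplePath G (r ∷ s ∷ q)) eR cp-simple) e

  explore : Progress G n0
  explore = combine (fresh w1 (nbrAdj (Others.o1N O)) (Others.o1p O)) (fresh w2 (nbrAdj (Others.o2N O)) (Others.o2p O))
    where
    ers : adj G r s ≡ true
    ers = trans (sy r s) (proj₁ cut-sr)
    D3r = deg3-view G r uniqueV deg-r
    O = others D3r (adj⇒Nbr pn r s ers)
    w1 = Others.o1 O
    w2 = Others.o2 O
    fresh : ∀ w → adj G r w ≡ true → w ≢ s → w ∉ P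
    fresh w e ws (here refl) = adj⇒≢ pn w w e refl
    fresh w e ws (there (here refl)) = ws refl
    fresh w e ws (there (there m)) = no-chord-at-r w m e
    start : ∀ w → adj G r w ≡ true → w ∉ P → (deg G w ≡ 1 → ⊥) → Progress G n0
    start w e nm nd = explore-from w [] (sp-cons w r (s ∷ rest) cp-simple nm wV (trans (sy w r) e) , d3)
      where
      wV : w ∈ V G
      wV = inV-target iV sy r w e
      d3 : ∀ v → v ∈ w ∷ [] → deg G v ≡ 3
      d3 v (here refl) = non-leaf⇒deg3 (net iv) wV nd
    la : deg G w1 ≡ 1 → Leaf G w1
    la d1 = nbrV (Others.o1N O) , d1
    lb : deg G w2 ≡ 1 → Leaf G w2
    lb d2 = nbrV (Others.o2N O) , d2
    both : w1 ∉ P → w2 ∉ P → deg G w1 ≡ 1 → deg G w2 ≡ 1 → Progress G n0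
    both n1 n2 d1 d2 = found (cherry w1 w2 r (mkCherryAt (Others.o12 O) (la d1) (lb d2)
                               (trans (sy w1 r) (nbrAdj (Others.o1N O))) (trans (sy w2 r) (nbrAdj (Others.o2N O)))
                               (three-leaves⇒≤ᵇ G w1 w2 x0 uniqueV (la d1) (lb d2) x0-leaf (Others.o12 O)
                                 (λ e → n1 (subst (_∈ P) (sym e) x0∈path)) (λ e → n2 (subst (_∈ P) (sym e) x0∈path)))))
    by-degrees : w1 ∉ P → w2 ∉ P → Dec (deg G w1 ≡ 1) → Dec (deg G w2 ≡ 1) → Progress G n0
    by-degrees n1 n2 (no nd) _ = start w1 (nbrAdj (Others.o1N O)) n1 nd
    by-degrees n1 n2 (yes _) (no nd) = start w2 (nbrAdj (Others.o2N O)) n2 nd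
    by-degrees n1 n2 (yes d1) (yes d2) = both n1 n2 d1 d2
    combine : w1 ∉ P → w2 ∉ P → Progress G n0
    combine n1 n2 = by-degrees n1 n2 (deg G w1 ≟ 1) (deg G w2 ≟ 1)

-- k bounds how much longer the path can still grow, since simple paths fit into V G.

search-from : ∀ {G} → TwoCuttableNetwork G → ∀ k (S : CutPath G) → length (V G) ≤ length (pathOf S) + k → Reducible G
search-from {G} iv k S bound = continue k bound (Search.explore G iv S)
  where
  continue : ∀ k → length (V G) ≤ length (pathOf S) + k → Progress G (length (pathOf S)) → Reducible G
  continue k bound (found red) = red
  continue zero bound (longer S′ grows) =
    ⊥-elim (n≮n (length (pathOf S)) (<-≤-trans grows (≤-trans path-fits (≤-trans bound (≤-reflexive (+-identityʳ _))))))
    where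
    path-fits : length (pathOf S′) ≤ length (V G)
    path-fits = simplePath-length≤ (pathOf S′) (IsNetwork.uniqueV (net iv)) (CutPath.cp-simple S′)
  continue (suc k) bound (longer S′ grows) =
    search-from iv k S′ (≤-trans bound (≤-trans (≤-reflexive (+-suc _ k)) (+-monoˡ-≤ k grows)))

reducible : ∀ G → TwoCuttableNetwork G → Reducible G
reducible G iv with IsNetwork.nonEmptyX (net iv)
... | x0 , lx0 with deg1-view G x0 (proj₂ lx0)
... | mkDeg1 p pN only with deg G p ≟ 1
... | yes d1 = single-edge x0 p lx0 (nbrV pN , d1) (nbrAdj pN)
... | no nd = search-from iv (length (V G)) S (m≤n+m _ _)
  where
  open IsNetwork (net iv)
  pn = network⇒simpleConnected (net iv)
  x0≢p : x0 ≢ p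
  x0≢p = adj⇒≢ pn x0 p (nbrAdj pN)
  px0 : adj G p x0 ≡ true
  px0 = trans (symmetric p x0) (nbrAdj pN)
  sp : SimplePath G (p ∷ x0 ∷ [])
  sp = mkSP (λ { z (here refl) → nbrV pN ; z (there (here refl)) → proj₁ lx0 })
            (uniq-cons (λ { (here e) → x0≢p (sym e) }) (uniq-cons (λ ()) uniq-nil)) (px0 , tt)
  cut : CutEdge G x0 p
  cut = cut-edge-swap G p x0 pn (pendant-edge-cut G p x0 px0 (λ z e → only z (adj⇒Nbr pn x0 z e)) x0≢p (proj₁ lx0) (nbrV pN))
  S : CutPath G
  S = mkCutPath p x0 [] sp cut (non-leaf⇒deg3 (net iv) (nbrV pN) nd) x0 (there (here refl)) lx0

reduceCherry-two-leaves : ∀ G x p → neighbours G x ≡ p ∷ [] → length (leaves G) ≡ 2 → reduceCherry G x ≡ deleteVertex G x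
reduceCherry-two-leaves G x p e1 e2 rewrite e1 | e2 = refl

module SingleEdge (G : Graph) (iv : TwoCuttableNetwork G) (x r : ℕ) (lx : Leaf G x) (lr : Leaf G r) (e : adj G x r ≡ true) where
  open IsNetwork (net iv)
  LX = leaf⇒LeafAt (net iv) lx e
  LR = leaf⇒LeafAt (net iv) lr (trans (symmetric r x) e)
  x≢r : x ≢ r
  x≢r = adj⇒≢ (network⇒simpleConnected (net iv)) x r e
  walk-stays : ∀ {a b} → Walk G a b → a ≡ x ⊎ a ≡ r → b ≡ x ⊎ b ≡ r
  walk-stays (here _) h = h
  walk-stays (step _ a w) (inj₁ refl) = walk-stays w (inj₂ (LeafAt.lonly LX _ a))
  walk-stays (step _ a w) (inj₂ refl) = walk-stays w (inj₁ (LeafAt.lonly LR _ a))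
  only-x-r : ∀ z → z ∈ V G → z ∈ x ∷ r ∷ []
  only-x-r z m with walk-stays (connected x z (proj₁ lx) m) (inj₁ refl)
  ... | inj₁ refl = here refl
  ... | inj₂ refl = there (here refl)
  two-leaves : length (leaves G) ≡ 2
  two-leaves = unique-sub-length≡ (leaves G) (x ∷ r ∷ []) (uniq-filter _ (V G) uniqueV)
    (uniq-cons (λ { (here q) → x≢r q }) (uniq-cons (λ ()) uniq-nil))
    (λ z m → only-x-r z (proj₁ (∈-filter⁻ {λ v → deg G v ≡ᵇ 1} (V G) m)))
    (λ { z (here refl) → leaf∈leaves lx ; z (there (here refl)) → leaf∈leaves lr })
  only-r : ∀ z → z ∈ V (deleteVertex G x) → z ∈ r ∷ []
  only-r z m with deleteVertex-V⁻ G x z m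
  ... | zV , z≢x with only-x-r z zV
  ... | here z≡x = ⊥-elim (z≢x z≡x)
  ... | there z∈r = z∈r
  V-deleteVertex : V (deleteVertex G x) ≡ r ∷ []
  V-deleteVertex with length≡1 _ (unique-sub-length≡ _ (r ∷ []) (uniq-deleteVertex G x uniqueV)
                                   (uniq-cons (λ ()) uniq-nil) only-r
                                   (λ { z (here refl) → deleteVertex-V⁺ G x r (proj₁ lr) (λ q → x≢r (sym q)) }))
  ... | a , eq with only-r a (subst (a ∈_) (sym eq) (here refl))
  ... | here refl = eq
  orchard : Orchard G
  orchard = (x , r) ∷ [] , inj₁ ((x≢r , lx , lr , inj₁ two-leaves) ,
              subst SingleVertex (sym (reduceCherry-two-leaves G x r (leaf-neighbours (net iv) lx e) two-leaves))
                (r , V-deleteVertex , deleteVertex-adj-false G x r r (irrefl r)))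

orchard-by-size : ∀ n G → length (V G) ≤ n → TwoCuttableNetwork G → Orchard G
orchard-by-size zero G le iv = ⊥-elim (n≮n 0 (<-≤-trans (∈-length (proj₁ (proj₂ (IsNetwork.nonEmptyX (net iv))))) le))
orchard-by-size (suc n) G le iv = reduce (reducible G iv)
  where
  recurse : ∀ {H} → ReducesTo G H → Orchard H
  recurse (iv′ , smaller) = orchard-by-size n _ (≤-pred (≤-trans smaller le)) iv′
  prepend : ∀ {H} pick → (∀ {s} → IsCherryPickingSeq H s → IsCherryPickingSeq G (pick ∷ s)) → Orchard H → Orchard G
  prepend pick extend (s , picks) = pick ∷ s , extend picks
  reduce : Reducible G → Orchard G
  reduce (single-edge x r lx lr e) = SingleEdge.orchard G iv x r lx lr e
  reduce (cherry x y p cd) =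
    prepend (x , y) (λ picks → inj₁ (CherryAt⇒IsCherry cd , picks)) (recurse (cherry-reduction iv cd))
  reduce (ret-cherry x y u v rc) =
    prepend (x , y) (λ picks → inj₂ (u , v , rc , picks)) (recurse (ret-cherry-reduction iv rc))

corollary1 : (U : Graph) → IsNetwork U → TwoCuttable U → Orchard U
corollary1 U net tc = orchard-by-size (length (V U)) U ≤-refl (mkTCN net tc)
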